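{- Consider a protocol in normal form and the attacker Eve with parameter $\varepsilon$ described in the context. For every $(M,\mathcal{I})$ denoting Eve's information up to just before the $i$-th query, if $\Pr_{\mathcal{EXEC}(M,\mathcal{I})}[\mathsf{Good}(M,\mathcal{I})]>0$, then there exist a distribution $\mathcal{A}$ over Alice's views up to that point and a distribution $\mathcal{B}$ over Bob's views up to that point such that \[\mathcal{GEXEC}(M,\mathcal{I})=(\mathcal{A}\times\mathcal{B})\mid \mathsf{Good}(M,\mathcal{I}),\] where $\mathcal{GEXEC}(M,\mathcal{I})$ is regarded as a distribution over pairs (Alice's view, Bob's view) (Eve's view being fixed to $(M,\mathcal{I})$), and the right-hand side is the product distribution conditioned on the event $Q(A)\cap Q(B)\subseteq Q(\mathcal{I})$.
   Context: Setting: $H:\{0,1\}^{\ell}\to\{0,1\}^{\ell}$ is a uniformly random oracle. Alice and Bob have private random tapes $r_a,r_b$ and run a protocol with oracle access to $H$; in odd rounds Alice queries and sends a message, in even rounds Bob does; no party asks the same query twice. Normal form: in each round the acting party makes exactly one oracle query, so there are $2n$ rounds. Eve sees all messages and may query $H$; after each message she performs her queries. An execution is a tuple $(r_a,h_a,r_b,h_b,\mathcal{I})$ where $h_a$ ($h_b$) is the sequence of oracle answers received by Alice (Bob) and $\mathcal{I}$ is the set of query/answer pairs learned by Eve; $\mathcal{EXEC}$ is the distribution of executions obtained with uniformly random tapes and a random oracle. A view of Alice consists of her random tape and the oracle answers she received (together with the messages, it determines her queries); similarly for Bob. For a message transcript $M$ so far and Eve's query/answer set $\mathcal{I}$, $\mathcal{EXEC}(M,\mathcal{I})$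 is the distribution of partial executions (up to the point the last message of $M$ is sent) conditioned on the transcript being $M$ and Eve's set being $\mathcal{I}$. For Alice's view $A$ let $Q(A)$ be her set of queries, similarly $Q(B)$ for Bob, and $Q(\mathcal{I})$ the queries in $\mathcal{I}$. $\mathsf{Good}(M,\mathcal{I})$ is the event $Q(A)\cap Q(B)\subseteq Q(\mathcal{I})$, and $\mathcal{GEXEC}(M,\mathcal{I})$ is $\mathcal{EXEC}(M,\mathcal{I})$ conditioned on $\mathsf{Good}(M,\mathcal{I})$. Eve's attack with parameter $\varepsilon$: at any point, with current $(M,\mathcal{I})$, for each $q$ let $p_q$ be the probability that $q$ is queried (by Alice or Bob) in a random execution from $\mathcal{GEXEC}(M,\mathcal{I})$; while some $p_q>\varepsilon/n$, Eve queries the lexicographically first such $q$ and adds it with its answer to $\mathcal{I}$; otherwise she waits for the next message.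
   Formalization: The parameter ε ranges over the positive rationals. -}

module Defs where

open import Data.Bool using (Bool; true; false; _∧_; _∨_; not; if_then_else_)
import Data.Bool.Properties as BoolP
open import Data.Nat using (ℕ; zero; suc; _<ᵇ_)
import Data.Nat as ℕ
open import Data.Integer using (+_)
open import Data.List using (List; []; _∷_; _++_; map; cartesianProduct; length; take; upTo; foldr)
open import Data.Bool.ListAction using (any; all)
import Data.List.Properties as ListP
open import Data.List.Relation.Unary.Unique.Propositional using (Unique)
open import Data.List.Membership.Propositional using (_∉_)
open import Data.Vec using (Vec; []; _∷_)
import Data.Vec.Properties as VecP
open import Data.Product using (_×_; _,_; proj₁; proj₂; Σ-syntax)
import Data.Product.Properties as ProdP
open import Data.Maybe using (Maybe; just; nothing)
open import Data.Rational using (ℚ; 0ℚ; 1ℚ; _/_)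
import Data.Rational as ℚ
import Data.Rational.Properties as ℚP
open import Relation.Nullary.Decidable using (does)
open import Relation.Binary.PropositionalEquality using (_≡_)

Str : ℕ → Set
Str ℓ = Vec Bool ℓ

allVec : (k : ℕ) → List (Vec Bool k)
allVec zero    = [] ∷ []
allVec (suc k) = map (false ∷_) (allVec k) ++ map (true ∷_) (allVec k)

listsOfLen : {A : Set} → List A → ℕ → List (List A)
listsOfLen xs zero    = [] ∷ []
listsOfLen xs (suc k) = foldr (λ l acc → map (_∷ l) xs ++ acc) [] (listsOfLen xs k)

-- A function {0,1}^ℓ → {0,1}^ℓ as a complete binary tree of depth ℓ
-- (a bijective representation; uniform over trees = uniform random oracle)
OracleT : ℕ → ℕ → Set
OracleT ℓ zero    = Str ℓ
OracleT ℓ (suc k) = OracleT ℓ k × OracleT ℓ k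

Oracle : ℕ → Set
Oracle ℓ = OracleT ℓ ℓ

allOracleT : (ℓ k : ℕ) → List (OracleT ℓ k)
allOracleT ℓ zero    = allVec ℓ
allOracleT ℓ (suc k) = cartesianProduct (allOracleT ℓ k) (allOracleT ℓ k)

applyT : ∀ {ℓ} (k : ℕ) → OracleT ℓ k → Vec Bool k → Str ℓ
applyT zero    t         []       = t
applyT (suc k) (t₀ , t₁) (b ∷ bs) = applyT k (if b then t₁ else t₀) bs

oracle : ∀ {ℓ} → Oracle ℓ → Str ℓ → Str ℓ
oracle {ℓ} H q = applyT ℓ H q

_==S_ : ∀ {ℓ} → Str ℓ → Str ℓ → Bool
x ==S y = does (VecP.≡-dec BoolP._≟_ x y)

elemS : ∀ {ℓ} → Str ℓ → List (Str ℓ) → Bool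
elemS q qs = any (q ==S_) qs

Msg : Set
Msg = List Bool

_==M_ : Msg → Msg → Bool
x ==M y = does (ListP.≡-dec BoolP._≟_ x y)

toℚ : ℕ → ℚ
toℚ k = (+ k) / 1

sumℚ : List ℚ → ℚ
sumℚ = foldr ℚ._+_ 0ℚ

indℚ : Bool → ℚ
indℚ true  = 1ℚ
indℚ false = 0ℚ

countᵇ : {A : Set} → (A → Bool) → List A → ℕ
countᵇ p = foldr (λ x acc → if p x then suc acc else acc) 0

-- A probability distribution on a type X, supported on the (duplicate-free)
-- finite list `supp`.
record Dist {X : Set} (supp : List X) : Set where
  field
    weight  : X → ℚ
    nonneg  : ∀ x → 0ℚ ℚ.≤ weight x
    outside : ∀ x → x ∉ supp → weight x ≡ 0ℚ
    total   : sumℚ (map weight supp) ≡ 1ℚ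
open Dist public

-- Rounds are numbered 0,1,2,...; even rounds (paper: odd rounds 1,3,..)
-- are Alice's, odd rounds Bob's.  In her round the acting party makes
-- exactly one oracle query (a function of her tape, her previous oracle
-- answers and the transcript so far), receives the answer and then sends a
-- message (a function of tape, answers including the new one, transcript).

record Protocol (ℓ ρa ρb : ℕ) : Set where
  field
    queryA : Vec Bool ρa → List (Str ℓ) → List Msg → Str ℓ
    msgA   : Vec Bool ρa → List (Str ℓ) → List Msg → Msg
    queryB : Vec Bool ρb → List (Str ℓ) → List Msg → Str ℓ
    msgB   : Vec Bool ρb → List (Str ℓ) → List Msg → Msg

aliceRound : ℕ → Bool
aliceRound zero    = true
aliceRound (suc k) = not (aliceRound k)

nA nB : ℕ → ℕ
nA zero    = zero
nA (suc k) = if aliceRound k then suc (nA k) else nA k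
nB zero    = zero
nB (suc k) = if aliceRound k then nB k else suc (nB k)

data Event (ℓ : ℕ) : Set where
  msgE : Msg → Event ℓ
  qryE : Str ℓ → Str ℓ → Event ℓ

-- Eve's history, most recent event first.
History : ℕ → Set
History ℓ = List (Event ℓ)

msgsOf : ∀ {ℓ} → History ℓ → List Msg
msgsOf []             = []
msgsOf (msgE m ∷ h)   = msgsOf h ++ (m ∷ [])
msgsOf (qryE _ _ ∷ h) = msgsOf h

infoOf : ∀ {ℓ} → History ℓ → List (Str ℓ × Str ℓ)
infoOf []             = []
infoOf (msgE _ ∷ h)   = infoOf h
infoOf (qryE q a ∷ h) = infoOf h ++ ((q , a) ∷ [])

isNothing : {A : Set} → Maybe A → Bool
isNothing nothing  = true
isNothing (just _) = false

isJust≡ : ∀ {ℓ} → Maybe (Str ℓ) → Str ℓ → Bool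
isJust≡ nothing  _ = false
isJust≡ (just x) q = x ==S q

firstᵇ : {A : Set} → (A → Bool) → List A → Maybe A
firstᵇ p []       = nothing
firstᵇ p (x ∷ xs) = if p x then just x else firstᵇ p xs

module Model {ℓ ρa ρb : ℕ} (P : Protocol ℓ ρa ρb) where
  open Protocol P

  -- sample space: (r_a , r_b , H), uniform
  Ω : Set
  Ω = Vec Bool ρa × Vec Bool ρb × Oracle ℓ

  allΩ : List Ω
  allΩ = cartesianProduct (allVec ρa) (cartesianProduct (allVec ρb) (allOracleT ℓ ℓ))

  -- (transcript, Alice's answers h_a, Bob's answers h_b)
  State : Set
  State = List Msg × List (Str ℓ) × List (Str ℓ)

  step : Ω → ℕ → State → Msg × State
  step (ra , rb , H) k (ms , ha , hb) =
    if aliceRound k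
    then (let a = oracle H (queryA ra ha ms)
              m = msgA ra (ha ++ (a ∷ [])) ms
          in m , (ms ++ (m ∷ []) , ha ++ (a ∷ []) , hb))
    else (let a = oracle H (queryB rb hb ms)
              m = msgB rb (hb ++ (a ∷ [])) ms
          in m , (ms ++ (m ∷ []) , ha , hb ++ (a ∷ [])))

  run : Ω → ℕ → State
  run ω zero    = [] , [] , []
  run ω (suc k) = proj₂ (step ω k (run ω k))

  roundMsg : Ω → ℕ → Msg
  roundMsg ω k = proj₁ (step ω k (run ω k))

  ViewA ViewB : Set
  ViewA = Vec Bool ρa × List (Str ℓ)
  ViewB = Vec Bool ρb × List (Str ℓ)

  queriesA : ViewA → List Msg → List (Str ℓ)
  queriesA (ra , ha) M = map (λ j → queryA ra (take j ha) (take (2 ℕ.* j) M)) (upTo (length ha))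

  queriesB : ViewB → List Msg → List (Str ℓ)
  queriesB (rb , hb) M = map (λ j → queryB rb (take j hb) (take (suc (2 ℕ.* j)) M)) (upTo (length hb))

  viewA : Ω → ℕ → ViewA
  viewA (ra , rb , H) k = ra , proj₁ (proj₂ (run (ra , rb , H) k))

  viewB : Ω → ℕ → ViewB
  viewB (ra , rb , H) k = rb , proj₂ (proj₂ (run (ra , rb , H) k))

  supA : ℕ → List ViewA
  supA k = cartesianProduct (allVec ρa) (listsOfLen (allVec ℓ) (nA k))

  supB : ℕ → List ViewB
  supB k = cartesianProduct (allVec ρb) (listsOfLen (allVec ℓ) (nB k))

  _==VA_ : ViewA → ViewA → Bool
  x ==VA y = does (ProdP.≡-dec (VecP.≡-dec BoolP._≟_) (ListP.≡-dec (VecP.≡-dec BoolP._≟_)) x y)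

  _==VB_ : ViewB → ViewB → Bool
  x ==VB y = does (ProdP.≡-dec (VecP.≡-dec BoolP._≟_) (ListP.≡-dec (VecP.≡-dec BoolP._≟_)) x y)

  goodQ : List (Str ℓ × Str ℓ) → List (Str ℓ) → List (Str ℓ) → Bool
  goodQ I qa qb = all (λ q → not (elemS q qb) ∨ elemS q (map proj₁ I)) qa

  goodV : List Msg → List (Str ℓ × Str ℓ) → ViewA → ViewB → Bool
  goodV M I a b = goodQ I (queriesA a M) (queriesB b M)

  NoRepeat : ℕ → Set
  NoRepeat n = ∀ (ω : Ω) → let k = 2 ℕ.* n ; ms = proj₁ (run ω k) in
    Unique (queriesA (viewA ω k) ms) × Unique (queriesB (viewB ω k) ms)

  module Eve (n : ℕ) (ε : ℚ) where
    mutual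
      reach : Ω → History ℓ → Bool
      reach ω []             = true
      reach ω (msgE m ∷ h)   =
        reach ω h ∧ isNothing (eveNext h)
          ∧ (length (msgsOf h) <ᵇ 2 ℕ.* n)
          ∧ (m ==M roundMsg ω (length (msgsOf h)))
      reach ω (qryE q a ∷ h) =
        reach ω h ∧ isJust≡ (eveNext h) q ∧ (a ==S oracle (proj₂ (proj₂ ω)) q)

      goodAt : History ℓ → Ω → Bool
      goodAt h ω = reach ω h ∧
        goodV (msgsOf h) (infoOf h) (viewA ω (length (msgsOf h))) (viewB ω (length (msgsOf h)))

      goodAndQueried : History ℓ → Str ℓ → Ω → Bool
      goodAndQueried h q ω = goodAt h ω ∧
        (elemS q (queriesA (viewA ω (length (msgsOf h))) (msgsOf h))
         ∨ elemS q (queriesB (viewB ω (length (msgsOf h))) (msgsOf h)))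

      -- p_q > ε / n, i.e. (#good∧queried / #good) > ε / n
      heavy : History ℓ → Str ℓ → Bool
      heavy h q = does ((ε ℚ.* toℚ (countᵇ (goodAt h) allΩ))
                          ℚP.<? (toℚ (countᵇ (goodAndQueried h q) allΩ) ℚ.* toℚ n))

      -- Eve's next query at history h (nothing = she waits for the next message):
      -- the lexicographically first q not yet in 𝓘 with p_q > ε/n.
      eveNext : History ℓ → Maybe (Str ℓ)
      eveNext h = firstᵇ (λ q → not (elemS q (map proj₁ (infoOf h))) ∧ heavy h q) (allVec ℓ)

    goodCount : History ℓ → ℕ
    goodCount h = countᵇ (goodAt h) allΩ

    countAB : History ℓ → ViewA → ViewB → ℕ
    countAB h a b = countᵇ (λ ω → goodAt h ω ∧ (viewA ω (length (msgsOf h)) ==VA a)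
                                              ∧ (viewB ω (length (msgsOf h)) ==VB b)) allΩ

  -- GEXEC(M,𝓘) = (𝒜 × ℬ) | Good(M,𝓘), written with cleared denominators:
  -- GEXEC(a,b) = countAB a b / goodCount, and the conditioned product is
  -- 𝒜(a)ℬ(b)[Good(a,b)] / D with D = Σ 𝒜(a')ℬ(b')[Good(a',b')] > 0.
  condProdWeight : (k : ℕ) → List Msg → List (Str ℓ × Str ℓ)
                 → Dist (supA k) → Dist (supB k) → ViewA → ViewB → ℚ
  condProdWeight k M I 𝒜 ℬ a b = weight 𝒜 a ℚ.* weight ℬ b ℚ.* indℚ (goodV M I a b)

  normaliser : (k : ℕ) → List Msg → List (Str ℓ × Str ℓ)
             → Dist (supA k) → Dist (supB k) → ℚ
  normaliser k M I 𝒜 ℬ =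
    sumℚ (map (λ a → sumℚ (map (λ b → condProdWeight k M I 𝒜 ℬ a b) (supB k))) (supA k))

  GEXECisCondProduct : (n : ℕ) (ε : ℚ) (h : History ℓ)
                     → Dist (supA (length (msgsOf h))) → Dist (supB (length (msgsOf h))) → Set
  GEXECisCondProduct n ε h 𝒜 ℬ =
    let open Eve n ε
        k = length (msgsOf h)
        D = normaliser k (msgsOf h) (infoOf h) 𝒜 ℬ
    in (0ℚ ℚ.< D) ×
       (∀ (a : ViewA) (b : ViewB) →
          toℚ (countAB h a b) ℚ.* D
            ≡ toℚ (goodCount h) ℚ.* condProdWeight k (msgsOf h) (infoOf h) 𝒜 ℬ a b)

-- Fix Eve's history h, with transcript M and query/answer list I.  A sample (r_a, r_b, H)
-- reaches h with views (a, b) exactly when Eve's own moves in h are the ones her strategy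
-- prescribes, each view is consistent with M (it has the right length and the messages its
-- owner sent are the ones it would send), and H agrees with the query/answer pairs claimed
-- by a, by b and by I.  So the number of such samples is
-- [admissible a b] · #{H consistent with C_a ++ C_b ++ I}.  Under Good(M, I) every query
-- shared by a and b lies in I, and counting oracles along the binary tree of H gives
-- #(C_a ++ C_b ++ I) · #I = #(C_a ++ I) · #(C_b ++ I).  Hence
-- GEXEC(a, b) · #I = [Good(a, b)] · F a · G b with F depending only on Alice's view and
-- G only on Bob's, and normalising F and G yields 𝒜 and ℬ.

{-# OPTIONS --safe #-}
module Submission where

open import Defs
open import Data.Bool using (Bool; true; false; _∧_; _∨_; not; if_then_else_; T)
import Data.Bool.Properties as BoolP
open import Data.Bool.ListAction using (all)
open import Data.Empty using (⊥-elim)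
open import Data.Unit using (tt)
open import Data.Nat using (ℕ; zero; suc; _+_; _*_; _≤_; _<_; z≤n; s≤s; _<ᵇ_; _≤′_; ≤′-refl; ≤′-step)
import Data.Nat.Properties as ℕP
import Algebra.Properties.CommutativeSemigroup as CommSemigroupP
open import Data.Nat.ListAction using (sum)
open import Data.List using (List; []; _∷_; _++_; map; cartesianProduct; length; foldr; take; upTo; initLast; _∷ʳ′_)
import Data.List.Properties as ListP
open import Data.List.Relation.Unary.Any using (here; there)
import Data.List.Relation.Unary.All as All
open import Data.List.Membership.Propositional using (_∈_; _∉_)
open import Data.List.Membership.Propositional.Properties using (∈-map⁻; ∈-++⁺ʳ; ∈-cartesianProduct⁻; ∈-upTo⁻)
open import Data.Vec using (Vec; []; _∷_; replicate)
import Data.Vec.Properties as VecP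
import Data.Product.Properties as ProdP
open import Data.Product using (_×_; _,_; proj₁; proj₂; Σ-syntax)
open import Data.Maybe using (nothing)
open import Data.Rational using (ℚ; 0ℚ) renaming (_<_ to _<ℚ_)
import Data.Rational as ℚ
import Data.Rational.Properties as ℚP
open import Relation.Binary.PropositionalEquality using (_≡_; refl; sym; trans; cong; cong₂; subst; subst₂; module ≡-Reasoning)
open import Relation.Binary.Definitions using (DecidableEquality)
open import Relation.Nullary using (Dec; yes; no; ¬_)
open import Relation.Nullary.Decidable using (does)

ind : Bool → ℕ
ind true  = 1
ind false = 0

ind-∧ : ∀ a b → ind (a ∧ b) ≡ ind a * ind b
ind-∧ true  b = sym (ℕP.+-identityʳ (ind b))
ind-∧ false b = refl

ind-* : ∀ a x → ind a * x ≤ x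
ind-* true  x = ℕP.≤-reflexive (ℕP.+-identityʳ x)
ind-* false x = z≤n

*-pos⁻ : ∀ a b → 0 < a * b → 0 < a × 0 < b
*-pos⁻ (suc a) (suc b) _ = s≤s z≤n , s≤s z≤n
*-pos⁻ (suc a) zero    p = ⊥-elim (ℕP.<-irrefl refl (subst (0 <_) (ℕP.*-zeroʳ a) p))

*-pos⁺ : ∀ a b → 0 < a → 0 < b → 0 < a * b
*-pos⁺ (suc a) (suc b) _ _ = s≤s z≤n

*-interchange : ∀ a b c e → (a * b) * (c * e) ≡ (a * c) * (b * e)
*-interchange = CommSemigroupP.interchange ℕP.*-commutativeSemigroup

T-injective : ∀ {a b : Bool} → (T a → T b) → (T b → T a) → a ≡ b
T-injective {false} {false} _ _ = refl
T-injective {false} {true}  _ g = ⊥-elim (g tt)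
T-injective {true}  {false} f _ = ⊥-elim (f tt)
T-injective {true}  {true}  _ _ = refl

T-∧⁻ : ∀ {a b} → T (a ∧ b) → T a × T b
T-∧⁻ {true} {true} _ = tt , tt

T-∧⁺ : ∀ {a b} → T a → T b → T (a ∧ b)
T-∧⁺ {true} {true} _ _ = tt

T-true : ∀ {b} → T b → b ≡ true
T-true {true} _ = refl

T-⇒ : ∀ {a b} → T (not a ∨ b) → T a → T b
T-⇒ {true} b _ = b

does⁻ : ∀ {p} {P : Set p} (d : Dec P) → T (does d) → P
does⁻ (yes x) _ = x

does⁺ : ∀ {p} {P : Set p} (d : Dec P) → P → T (does d)
does⁺ (yes _) _  = tt
does⁺ (no ¬x) x = ¬x x

module _ {A : Set} where

  count-cong : {p q : A → Bool} → (∀ x → p x ≡ q x) → ∀ xs → countᵇ p xs ≡ countᵇ q xs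
  count-cong e [] = refl
  count-cong {p} {q} e (x ∷ xs) rewrite e x with q x
  ... | true  = cong suc (count-cong e xs)
  ... | false = count-cong e xs

  count-∷ : (p : A → Bool) → ∀ x xs → countᵇ p (x ∷ xs) ≡ ind (p x) + countᵇ p xs
  count-∷ p x xs with p x
  ... | true  = refl
  ... | false = refl

  count-++ : (p : A → Bool) → ∀ xs ys → countᵇ p (xs ++ ys) ≡ countᵇ p xs + countᵇ p ys
  count-++ p []       ys = refl
  count-++ p (x ∷ xs) ys with p x
  ... | true  = cong suc (count-++ p xs ys)
  ... | false = count-++ p xs ys

  count-none : (p : A → Bool) → (∀ x → p x ≡ false) → ∀ xs → countᵇ p xs ≡ 0
  count-none p e []       = refl
  count-none p e (x ∷ xs) rewrite e x = count-none p e xs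

  count-∧ˡ : (c : Bool) (p : A → Bool) → ∀ xs → countᵇ (λ x → c ∧ p x) xs ≡ ind c * countᵇ p xs
  count-∧ˡ true  p xs = sym (ℕP.+-identityʳ _)
  count-∧ˡ false p xs = count-none _ (λ _ → refl) xs

  count≡sum : (p : A → Bool) → ∀ xs → countᵇ p xs ≡ sum (map (λ x → ind (p x)) xs)
  count≡sum p []       = refl
  count≡sum p (x ∷ xs) = trans (count-∷ p x xs) (cong (ind (p x) +_) (count≡sum p xs))

  count>0⇒∃ : (p : A → Bool) → ∀ xs → 0 < countᵇ p xs → Σ[ x ∈ A ] (x ∈ xs × T (p x))
  count>0⇒∃ p (x ∷ xs) pos with p x in eq
  ... | true  = x , here refl , subst T (sym eq) tt
  ... | false with count>0⇒∃ p xs pos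
  ...   | y , y∈xs , py = y , there y∈xs , py

  ∃⇒count>0 : (p : A → Bool) → ∀ {x} xs → x ∈ xs → T (p x) → 0 < countᵇ p xs
  ∃⇒count>0 p (y ∷ xs) (here refl) px rewrite T-true px = s≤s z≤n
  ∃⇒count>0 p (y ∷ xs) (there x∈xs) px with p y
  ... | true  = s≤s z≤n
  ... | false = ∃⇒count>0 p xs x∈xs px

count-map : {A B : Set} (p : B → Bool) (f : A → B) → ∀ xs → countᵇ p (map f xs) ≡ countᵇ (λ x → p (f x)) xs
count-map p f []       = refl
count-map p f (x ∷ xs) with p (f x)
... | true  = cong suc (count-map p f xs)
... | false = count-map p f xs

count-cartesianProduct : {A B : Set} (p : A → Bool) (q : B → Bool) → ∀ xs ys →
  countᵇ (λ z → p (proj₁ z) ∧ q (proj₂ z)) (cartesianProduct xs ys) ≡ countᵇ p xs * countᵇ q ys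
count-cartesianProduct p q []       ys = refl
count-cartesianProduct p q (x ∷ xs) ys = begin
  countᵇ r (map (x ,_) ys ++ cartesianProduct xs ys)
    ≡⟨ count-++ r (map (x ,_) ys) (cartesianProduct xs ys) ⟩
  countᵇ r (map (x ,_) ys) + countᵇ r (cartesianProduct xs ys)
    ≡⟨ cong₂ _+_ (trans (count-map r (x ,_) ys) (count-∧ˡ (p x) q ys)) (count-cartesianProduct p q xs ys) ⟩
  ind (p x) * countᵇ q ys + countᵇ p xs * countᵇ q ys
    ≡⟨ sym (ℕP.*-distribʳ-+ (countᵇ q ys) (ind (p x)) (countᵇ p xs)) ⟩
  (ind (p x) + countᵇ p xs) * countᵇ q ys
    ≡⟨ cong (_* countᵇ q ys) (sym (count-∷ p x xs)) ⟩
  countᵇ p (x ∷ xs) * countᵇ q ys ∎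
  where
  open ≡-Reasoning
  r = λ z → p (proj₁ z) ∧ q (proj₂ z)

sumMap : {A : Set} → (A → ℕ) → List A → ℕ
sumMap f xs = sum (map f xs)

module _ {A : Set} where

  sumMap-cong : {f g : A → ℕ} → (∀ x → f x ≡ g x) → ∀ xs → sumMap f xs ≡ sumMap g xs
  sumMap-cong e []       = refl
  sumMap-cong e (x ∷ xs) = cong₂ _+_ (e x) (sumMap-cong e xs)

  sumMap-+ : (f g : A → ℕ) → ∀ xs → sumMap (λ x → f x + g x) xs ≡ sumMap f xs + sumMap g xs
  sumMap-+ f g []       = refl
  sumMap-+ f g (x ∷ xs) rewrite sumMap-+ f g xs =
    CommSemigroupP.interchange ℕP.+-commutativeSemigroup (f x) (g x) (sumMap f xs) (sumMap g xs)

  sumMap-zero : ∀ xs → sumMap (λ (_ : A) → 0) xs ≡ 0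
  sumMap-zero []       = refl
  sumMap-zero (x ∷ xs) = sumMap-zero xs

  sumMap-*ˡ : (c : ℕ) (f : A → ℕ) → ∀ xs → sumMap (λ x → c * f x) xs ≡ c * sumMap f xs
  sumMap-*ˡ c f []       = sym (ℕP.*-zeroʳ c)
  sumMap-*ˡ c f (x ∷ xs) =
    trans (cong (c * f x +_) (sumMap-*ˡ c f xs)) (sym (ℕP.*-distribˡ-+ c (f x) _))

  sumMap-*ʳ : (c : ℕ) (f : A → ℕ) → ∀ xs → sumMap f xs * c ≡ sumMap (λ x → f x * c) xs
  sumMap-*ʳ c f xs = trans (ℕP.*-comm (sumMap f xs) c)
    (trans (sym (sumMap-*ˡ c f xs)) (sumMap-cong (λ x → ℕP.*-comm c (f x)) xs))

  sumMap-mono-≤ : {f g : A → ℕ} → (∀ x → f x ≤ g x) → ∀ xs → sumMap f xs ≤ sumMap g xs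
  sumMap-mono-≤ e []       = z≤n
  sumMap-mono-≤ e (x ∷ xs) = ℕP.+-mono-≤ (e x) (sumMap-mono-≤ e xs)

sumMap-comm : {A B : Set} (f : A → B → ℕ) → ∀ xs ys →
  sumMap (λ x → sumMap (f x) ys) xs ≡ sumMap (λ y → sumMap (λ x → f x y) xs) ys
sumMap-comm f []       ys = sym (sumMap-zero ys)
sumMap-comm f (x ∷ xs) ys = trans (cong (sumMap (f x) ys +_) (sumMap-comm f xs ys))
  (sym (sumMap-+ (f x) (λ y → sumMap (λ x₁ → f x₁ y) xs) ys))

_Selects_ : {A : Set} → (A → Bool) → A → Set
e Selects x = ∀ y → (T (e y) → x ≡ y) × (x ≡ y → T (e y))

does-Selects : {A : Set} (x : A) (x≟_ : ∀ y → Dec (x ≡ y)) → (λ y → does (x≟ y)) Selects x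
does-Selects x x≟_ y = does⁻ (x≟ y) , does⁺ (x≟ y)

module _ {A : Set} {e : A → Bool} {x : A} (e-sel : e Selects x) where

  Selects-rejects : ∀ y → ¬ (x ≡ y) → e y ≡ false
  Selects-rejects y x≢y with e y in ey
  ... | true  = ⊥-elim (x≢y (proj₁ (e-sel y) (subst T (sym ey) tt)))
  ... | false = refl

  Selects-unique : ∀ {e′} → e′ Selects x → ∀ y → e y ≡ e′ y
  Selects-unique e′-sel y = T-injective
    (λ ey → proj₂ (e′-sel y) (proj₁ (e-sel y) ey)) (λ e′y → proj₂ (e-sel y) (proj₁ (e′-sel y) e′y))

  count-Selects-singleton : countᵇ e (x ∷ []) ≡ 1
  count-Selects-singleton rewrite T-true (proj₂ (e-sel x) refl) = refl

module _ {A : Set} {e : List A → Bool} {y : A} {ys : List A} (e-sel : e Selects (y ∷ ys)) where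

  Selects-head : (λ z → e (z ∷ ys)) Selects y
  Selects-head z = (λ ez → proj₁ (ListP.∷-injective (proj₁ (e-sel (z ∷ ys)) ez)))
                 , λ { refl → proj₂ (e-sel (y ∷ ys)) refl }

  Selects-other-tail : ∀ {l} → ¬ (ys ≡ l) → ∀ z → e (z ∷ l) ≡ false
  Selects-other-tail ys≢l z = Selects-rejects e-sel (z ∷ _) λ eq → ys≢l (proj₂ (ListP.∷-injective eq))

module _ {A : Set} {k} {e : Vec A (suc k) → Bool} {y : A} {ys : Vec A k} (e-sel : e Selects (y ∷ ys)) where

  Selects-tail : (λ zs → e (y ∷ zs)) Selects ys
  Selects-tail zs = (λ ezs → proj₂ (VecP.∷-injective (proj₁ (e-sel (y ∷ zs)) ezs)))
                  , λ { refl → proj₂ (e-sel (y ∷ ys)) refl }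

  Selects-other-head : ∀ {z} → ¬ (y ≡ z) → ∀ zs → e (z ∷ zs) ≡ false
  Selects-other-head y≢z zs = Selects-rejects e-sel (_ ∷ zs) λ eq → y≢z (proj₁ (VecP.∷-injective eq))

count-allVec-suc : ∀ k (e : Vec Bool (suc k) → Bool) →
  countᵇ e (allVec (suc k)) ≡ countᵇ (λ zs → e (false ∷ zs)) (allVec k) + countᵇ (λ zs → e (true ∷ zs)) (allVec k)
count-allVec-suc k e =
  trans (count-++ e (map (false ∷_) (allVec k)) (map (true ∷_) (allVec k)))
        (cong₂ _+_ (count-map e (false ∷_) (allVec k)) (count-map e (true ∷_) (allVec k)))

Enumerates : {A : Set} → List A → Set
Enumerates {A} xs = ∀ {x : A} (e : A → Bool) → e Selects x → countᵇ e xs ≡ 1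

allVec-Enumerates : ∀ k → Enumerates (allVec k)
allVec-Enumerates zero    {[]}        e e-sel = count-Selects-singleton e-sel
allVec-Enumerates (suc k) {false ∷ x} e e-sel = trans (count-allVec-suc k e)
  (cong₂ _+_ (allVec-Enumerates k _ (Selects-tail e-sel)) (count-none _ (Selects-other-head e-sel λ ()) (allVec k)))
allVec-Enumerates (suc k) {true ∷ x}  e e-sel = trans (count-allVec-suc k e)
  (cong₂ _+_ (count-none _ (Selects-other-head e-sel λ ()) (allVec k)) (allVec-Enumerates k _ (Selects-tail e-sel)))

module _ {A : Set} (_≟_ : DecidableEquality A) {xs : List A} (xs-enum : Enumerates xs) where

  private
    _≟L_ : DecidableEquality (List A)
    _≟L_ = ListP.≡-dec _≟_

  count-prepend-all : ∀ {y ys} (e : List A → Bool) → e Selects (y ∷ ys) → ∀ L →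
    countᵇ e (foldr (λ l acc → map (_∷ l) xs ++ acc) [] L) ≡ countᵇ (λ l → does (ys ≟L l)) L
  count-prepend-all e e-sel [] = refl
  count-prepend-all {ys = ys} e e-sel (l ∷ L) =
    trans (count-++ e (map (_∷ l) xs) _)
    (trans (cong₂ _+_ (trans (count-map e (_∷ l) xs) (count-heads (ys ≟L l))) (count-prepend-all e e-sel L))
    (sym (count-∷ _ l L)))
    where
    count-heads : (d : Dec (ys ≡ l)) → countᵇ (λ z → e (z ∷ l)) xs ≡ ind (does d)
    count-heads (yes refl)  = xs-enum _ (Selects-head e-sel)
    count-heads (no  ys≢l) = count-none _ (Selects-other-tail e-sel ys≢l) xs

  count-listsOfLen : ∀ k {ys} (e : List A → Bool) → length ys ≡ k → e Selects ys →
    countᵇ e (listsOfLen xs k) ≡ 1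
  count-listsOfLen zero    {[]}     e refl e-sel = count-Selects-singleton e-sel
  count-listsOfLen (suc k) {y ∷ ys} e refl e-sel =
    trans (count-prepend-all e e-sel (listsOfLen xs k))
          (count-listsOfLen k _ refl (does-Selects ys (ys ≟L_)))

module _ {A B : Set} {ex : A → Bool} {ey : B → Bool} {x : A} {y : B} where

  Selects-× : ex Selects x → ey Selects y → (λ z → ex (proj₁ z) ∧ ey (proj₂ z)) Selects (x , y)
  Selects-× ex-sel ey-sel (a , b) =
      (λ exy → let exa , eyb = T-∧⁻ exy in cong₂ _,_ (proj₁ (ex-sel a) exa) (proj₁ (ey-sel b) eyb))
    , λ { refl → T-∧⁺ (proj₂ (ex-sel x) refl) (proj₂ (ey-sel y) refl) }

  count-cartesianProduct-Selects : ∀ {xs ys} → ex Selects x → ey Selects y →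
    countᵇ ex xs ≡ 1 → countᵇ ey ys ≡ 1 →
    ∀ (e : A × B → Bool) → e Selects (x , y) → countᵇ e (cartesianProduct xs ys) ≡ 1
  count-cartesianProduct-Selects {xs} {ys} ex-sel ey-sel #x #y e e-sel =
    trans (count-cong (Selects-unique e-sel (Selects-× ex-sel ey-sel)) (cartesianProduct xs ys))
          (trans (count-cartesianProduct ex ey xs ys) (cong₂ _*_ #x #y))

module _ {ℓ : ℕ} where

  View : ℕ → Set
  View ρ = Vec Bool ρ × List (Str ℓ)

  _≟View_ : ∀ {ρ} → DecidableEquality (View ρ)
  _≟View_ = ProdP.≡-dec (VecP.≡-dec BoolP._≟_) (ListP.≡-dec (VecP.≡-dec BoolP._≟_))

  views : (ρ m : ℕ) → List (View ρ)
  views ρ m = cartesianProduct (allVec ρ) (listsOfLen (allVec ℓ) m)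

  count-views : ∀ {ρ m} (r : Vec Bool ρ) (hs : List (Str ℓ)) → length hs ≡ m →
    countᵇ (λ v → does ((r , hs) ≟View v)) (views ρ m) ≡ 1
  count-views {ρ} {m} r hs len =
    count-cartesianProduct-Selects {ex = λ r′ → does (r ≟Vec r′)} {ey = λ hs′ → does (hs ≟Str* hs′)}
      {xs = allVec ρ} {ys = listsOfLen (allVec ℓ) m} r-sel hs-sel
      (allVec-Enumerates ρ _ r-sel)
      (count-listsOfLen (VecP.≡-dec BoolP._≟_) (allVec-Enumerates ℓ) m _ len hs-sel)
      _ (does-Selects (r , hs) ((r , hs) ≟View_))
    where
    _≟Vec_ = VecP.≡-dec BoolP._≟_
    _≟Str*_ = ListP.≡-dec (VecP.≡-dec BoolP._≟_)
    r-sel  = does-Selects r (r ≟Vec_)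
    hs-sel = does-Selects hs (hs ≟Str*_)

  ∈-views : ∀ {ρ m} (r : Vec Bool ρ) (hs : List (Str ℓ)) → length hs ≡ m → (r , hs) ∈ views ρ m
  ∈-views r hs len with count>0⇒∃ _ _ (subst (0 <_) (sym (count-views r hs len)) (s≤s z≤n))
  ... | v , v∈views , eq = subst (_∈ _) (sym (does⁻ ((r , hs) ≟View v) eq)) v∈views

all-++ : {A : Set} (f : A → Bool) (xs ys : List A) → all f (xs ++ ys) ≡ all f xs ∧ all f ys
all-++ f []       ys = refl
all-++ f (x ∷ xs) ys = trans (cong (f x ∧_) (all-++ f xs ys)) (sym (BoolP.∧-assoc (f x) _ _))

all-∈ : {A : Set} (f : A → Bool) {x : A} (xs : List A) → T (all f xs) → x ∈ xs → T (f x)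
all-∈ f (x ∷ xs) fxs (here refl) = proj₁ (T-∧⁻ fxs)
all-∈ f (x ∷ xs) fxs (there x∈) = all-∈ f xs (proj₂ (T-∧⁻ fxs)) x∈

module _ {ℓ : ℕ} where

  ∈⇒elemS : ∀ {q : Str ℓ} qs → q ∈ qs → T (elemS q qs)
  ∈⇒elemS {q} (q′ ∷ qs) (here refl) rewrite T-true (does⁺ (VecP.≡-dec BoolP._≟_ q q) refl) = tt
  ∈⇒elemS {q} (q′ ∷ qs) (there q∈) with q ==S q′
  ... | true  = tt
  ... | false = ∈⇒elemS qs q∈

  elemS⇒∈ : ∀ {q : Str ℓ} qs → T (elemS q qs) → q ∈ qs
  elemS⇒∈ {q} (q′ ∷ qs) t with VecP.≡-dec BoolP._≟_ q q′
  ... | yes refl = here refl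
  ... | no  _    = there (elemS⇒∈ qs t)

module _ {ℓ : ℕ} where

  Constraints : ℕ → Set
  Constraints d = List (Vec Bool d × Str ℓ)

  queriesOf : ∀ {d} → Constraints d → List (Vec Bool d)
  queriesOf = map proj₁

  consistent : ∀ d → OracleT ℓ d → Constraints d → Bool
  consistent d t C = all (λ p → proj₂ p ==S applyT d t (proj₁ p)) C

  #consistent : ∀ d → Constraints d → ℕ
  #consistent d C = countᵇ (λ t → consistent d t C) (allOracleT ℓ d)

  consistent-++ : ∀ d t (C C′ : Constraints d) → consistent d t (C ++ C′) ≡ consistent d t C ∧ consistent d t C′
  consistent-++ d t = all-++ _

  branch : ∀ {d} → Bool → Constraints (suc d) → Constraints d
  branch b [] = []
  branch false (((false ∷ q) , v) ∷ C) = (q , v) ∷ branch false C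
  branch false (((true  ∷ q) , v) ∷ C) = branch false C
  branch true  (((false ∷ q) , v) ∷ C) = branch true C
  branch true  (((true  ∷ q) , v) ∷ C) = (q , v) ∷ branch true C

  branch-++ : ∀ {d} b (C C′ : Constraints (suc d)) → branch b (C ++ C′) ≡ branch b C ++ branch b C′
  branch-++ b [] C′ = refl
  branch-++ false (((false ∷ q) , v) ∷ C) C′ = cong ((q , v) ∷_) (branch-++ false C C′)
  branch-++ false (((true  ∷ q) , v) ∷ C) C′ = branch-++ false C C′
  branch-++ true  (((false ∷ q) , v) ∷ C) C′ = branch-++ true C C′
  branch-++ true  (((true  ∷ q) , v) ∷ C) C′ = cong ((q , v) ∷_) (branch-++ true C C′)

  ∈-branch⁺ : ∀ {d} b (C : Constraints (suc d)) {q} → (b ∷ q) ∈ queriesOf C → q ∈ queriesOf (branch b C)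
  ∈-branch⁺ false (((false ∷ _) , _) ∷ C) (here refl) = here refl
  ∈-branch⁺ false (((false ∷ _) , _) ∷ C) (there q∈) = there (∈-branch⁺ false C q∈)
  ∈-branch⁺ false (((true  ∷ _) , _) ∷ C) (there q∈) = ∈-branch⁺ false C q∈
  ∈-branch⁺ true  (((false ∷ _) , _) ∷ C) (there q∈) = ∈-branch⁺ true C q∈
  ∈-branch⁺ true  (((true  ∷ _) , _) ∷ C) (here refl) = here refl
  ∈-branch⁺ true  (((true  ∷ _) , _) ∷ C) (there q∈) = there (∈-branch⁺ true C q∈)

  ∈-branch⁻ : ∀ {d} b (C : Constraints (suc d)) {q} → q ∈ queriesOf (branch b C) → (b ∷ q) ∈ queriesOf C
  ∈-branch⁻ false (((false ∷ _) , _) ∷ C) (here refl) = here refl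
  ∈-branch⁻ false (((false ∷ _) , _) ∷ C) (there q∈) = there (∈-branch⁻ false C q∈)
  ∈-branch⁻ false (((true  ∷ _) , _) ∷ C) q∈         = there (∈-branch⁻ false C q∈)
  ∈-branch⁻ true  (((false ∷ _) , _) ∷ C) q∈         = there (∈-branch⁻ true C q∈)
  ∈-branch⁻ true  (((true  ∷ _) , _) ∷ C) (here refl) = here refl
  ∈-branch⁻ true  (((true  ∷ _) , _) ∷ C) (there q∈) = there (∈-branch⁻ true C q∈)

  consistent-node : ∀ d t₀ t₁ (C : Constraints (suc d)) →
    consistent (suc d) (t₀ , t₁) C ≡ consistent d t₀ (branch false C) ∧ consistent d t₁ (branch true C)
  consistent-node d t₀ t₁ [] = refl
  consistent-node d t₀ t₁ (((false ∷ q) , v) ∷ C) rewrite consistent-node d t₀ t₁ C =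
    sym (BoolP.∧-assoc (v ==S applyT d t₀ q) _ _)
  consistent-node d t₀ t₁ (((true  ∷ q) , v) ∷ C) rewrite consistent-node d t₀ t₁ C =
    ∧-swapˡ (v ==S applyT d t₁ q) (consistent d t₀ (branch false C)) _
    where
    ∧-swapˡ : ∀ a x y → a ∧ (x ∧ y) ≡ x ∧ (a ∧ y)
    ∧-swapˡ true  x y = refl
    ∧-swapˡ false x y = sym (BoolP.∧-zeroʳ x)

  #consistent-node : ∀ d (C : Constraints (suc d)) →
    #consistent (suc d) C ≡ #consistent d (branch false C) * #consistent d (branch true C)
  #consistent-node d C =
    trans (count-cong (λ t → consistent-node d (proj₁ t) (proj₂ t) C) (allOracleT ℓ (suc d)))
          (count-cartesianProduct (λ t → consistent d t (branch false C)) (λ t → consistent d t (branch true C))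
                                  (allOracleT ℓ d) (allOracleT ℓ d))

  answersAll : ∀ {d} → Str ℓ → Constraints d → Bool
  answersAll v C = all (λ p → proj₂ p ==S v) C

  consistent-leaf : ∀ t (C : Constraints 0) → consistent 0 t C ≡ answersAll t C
  consistent-leaf t [] = refl
  consistent-leaf t (([] , v) ∷ C) = cong ((v ==S t) ∧_) (consistent-leaf t C)

  #consistent-leaf : ∀ (C : Constraints 0) {q v} → (q , v) ∈ C → #consistent 0 C ≡ ind (answersAll v C)
  #consistent-leaf C {q} {v} qv∈C =
    trans (count-cong consistent≡ (allVec ℓ))
          (trans (count-∧ˡ (answersAll v C) (v ==S_) (allVec ℓ))
                 (trans (cong (ind (answersAll v C) *_) (allVec-Enumerates ℓ _ (does-Selects v (v ≟S_))))
                        (ℕP.*-identityʳ _)))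
    where
    _≟S_ = VecP.≡-dec BoolP._≟_
    consistent≡ : ∀ t → consistent 0 t C ≡ answersAll v C ∧ (v ==S t)
    consistent≡ t rewrite consistent-leaf t C = T-injective to from
      where
      to : T (answersAll t C) → T (answersAll v C ∧ (v ==S t))
      to all-t with does⁻ (v ≟S t) (all-∈ (λ p → proj₂ p ==S t) C all-t qv∈C)
      ... | refl = T-∧⁺ all-t (does⁺ (v ≟S v) refl)
      from : T (answersAll v C ∧ (v ==S t)) → T (answersAll t C)
      from all-v with does⁻ (v ≟S t) (proj₂ (T-∧⁻ all-v))
      ... | refl = proj₁ (T-∧⁻ all-v)

  SharedWithin : ∀ {d} → Constraints d → Constraints d → Constraints d → Set
  SharedWithin C₁ C₂ C₀ = ∀ q → q ∈ queriesOf C₁ → q ∈ queriesOf C₂ → q ∈ queriesOf C₀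

  SharedWithin-branch : ∀ {d} b {C₁ C₂ C₀ : Constraints (suc d)} → SharedWithin C₁ C₂ C₀ →
    SharedWithin (branch b C₁) (branch b C₂) (branch b C₀)
  SharedWithin-branch b {C₁} {C₂} {C₀} shared q q∈₁ q∈₂ =
    ∈-branch⁺ b C₀ (shared (b ∷ q) (∈-branch⁻ b C₁ q∈₁) (∈-branch⁻ b C₂ q∈₂))

  private
    ind-∧-shared : ∀ a b c → ind (a ∧ (b ∧ c)) * ind c ≡ ind (a ∧ c) * ind (b ∧ c)
    ind-∧-shared true  true  true  = refl
    ind-∧-shared true  true  false = refl
    ind-∧-shared true  false c     = sym (ℕP.*-zeroʳ (ind c))
    ind-∧-shared false b     c     = refl

    #consistent-leaf-++ : ∀ (C C₀ : Constraints 0) {q v} → (q , v) ∈ C₀ →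
      #consistent 0 (C ++ C₀) ≡ ind (answersAll v C ∧ answersAll v C₀)
    #consistent-leaf-++ C C₀ qv∈C₀ =
      trans (#consistent-leaf (C ++ C₀) (∈-++⁺ʳ C qv∈C₀)) (cong ind (all-++ _ C C₀))

  #consistent-independent-leaf : ∀ (C₁ C₂ C₀ : Constraints 0) {q v} → (q , v) ∈ C₀ →
    #consistent 0 (C₁ ++ C₂ ++ C₀) * #consistent 0 C₀ ≡ #consistent 0 (C₁ ++ C₀) * #consistent 0 (C₂ ++ C₀)
  #consistent-independent-leaf C₁ C₂ C₀ {v = v} qv∈C₀ = begin
    #consistent 0 (C₁ ++ C₂ ++ C₀) * #consistent 0 C₀
      ≡⟨ cong₂ _*_ (trans (#consistent-leaf-++ C₁ (C₂ ++ C₀) (∈-++⁺ʳ C₂ qv∈C₀))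
                          (cong (λ x → ind (answersAll v C₁ ∧ x)) (all-++ _ C₂ C₀)))
                   (#consistent-leaf C₀ qv∈C₀) ⟩
    ind (answersAll v C₁ ∧ (answersAll v C₂ ∧ answersAll v C₀)) * ind (answersAll v C₀)
      ≡⟨ ind-∧-shared (answersAll v C₁) (answersAll v C₂) (answersAll v C₀) ⟩
    ind (answersAll v C₁ ∧ answersAll v C₀) * ind (answersAll v C₂ ∧ answersAll v C₀)
      ≡⟨ sym (cong₂ _*_ (#consistent-leaf-++ C₁ C₀ qv∈C₀) (#consistent-leaf-++ C₂ C₀ qv∈C₀)) ⟩
    #consistent 0 (C₁ ++ C₀) * #consistent 0 (C₂ ++ C₀) ∎
    where open ≡-Reasoning

  -- Subtrees of the oracle are independent; at a leaf, a query shared by C₁ and C₂ is also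
  -- constrained by C₀, which fixes the answer for both.
  #consistent-independent : ∀ d (C₁ C₂ C₀ : Constraints d) → SharedWithin C₁ C₂ C₀ →
    #consistent d (C₁ ++ C₂ ++ C₀) * #consistent d C₀ ≡ #consistent d (C₁ ++ C₀) * #consistent d (C₂ ++ C₀)
  #consistent-independent d [] C₂ C₀ _ = ℕP.*-comm (#consistent d (C₂ ++ C₀)) (#consistent d C₀)
  #consistent-independent d (p₁ ∷ C₁) [] C₀ _ = refl
  #consistent-independent zero (([] , v₁) ∷ C₁) (([] , v₂) ∷ C₂) C₀ shared
    with ∈-map⁻ proj₁ (shared [] (here refl) (here refl))
  ... | _ , qv∈C₀ , _ = #consistent-independent-leaf (([] , v₁) ∷ C₁) (([] , v₂) ∷ C₂) C₀ qv∈C₀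
  #consistent-independent (suc d) C₁ C₂ C₀ shared = begin
    N′ (C₁ ++ C₂ ++ C₀) * N′ C₀
      ≡⟨ cong₂ _*_ (trans (#consistent-node d (C₁ ++ C₂ ++ C₀)) (cong₂ _*_ (split false) (split true)))
                   (#consistent-node d C₀) ⟩
    (N (L C₁ ++ L C₂ ++ L C₀) * N (R C₁ ++ R C₂ ++ R C₀)) * (N (L C₀) * N (R C₀))
      ≡⟨ *-interchange (N (L C₁ ++ L C₂ ++ L C₀)) _ _ _ ⟩
    (N (L C₁ ++ L C₂ ++ L C₀) * N (L C₀)) * (N (R C₁ ++ R C₂ ++ R C₀) * N (R C₀))
      ≡⟨ cong₂ _*_ (#consistent-independent d (L C₁) (L C₂) (L C₀) (SharedWithin-branch false shared))
                   (#consistent-independent d (R C₁) (R C₂) (R C₀) (SharedWithin-branch true shared)) ⟩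
    (N (L C₁ ++ L C₀) * N (L C₂ ++ L C₀)) * (N (R C₁ ++ R C₀) * N (R C₂ ++ R C₀))
      ≡⟨ *-interchange (N (L C₁ ++ L C₀)) _ _ _ ⟩
    (N (L C₁ ++ L C₀) * N (R C₁ ++ R C₀)) * (N (L C₂ ++ L C₀) * N (R C₂ ++ R C₀))
      ≡⟨ sym (cong₂ _*_ (node-++ C₁) (node-++ C₂)) ⟩
    N′ (C₁ ++ C₀) * N′ (C₂ ++ C₀) ∎
    where
    open ≡-Reasoning
    N = #consistent d
    N′ = #consistent (suc d)
    L = branch false
    R = branch true
    split : ∀ b → N (branch b (C₁ ++ C₂ ++ C₀)) ≡ N (branch b C₁ ++ branch b C₂ ++ branch b C₀)
    split b = cong N (trans (branch-++ b C₁ _) (cong (branch b C₁ ++_) (branch-++ b C₂ C₀)))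
    node-++ : ∀ C → N′ (C ++ C₀) ≡ N (L C ++ L C₀) * N (R C ++ R C₀)
    node-++ C = trans (#consistent-node d (C ++ C₀))
                      (cong₂ _*_ (cong N (branch-++ false C C₀)) (cong N (branch-++ true C C₀)))

data Turn (k : ℕ) : Set where
  alice : aliceRound k ≡ true  → nA k ≡ nB k       → 2 * nA k ≡ k       → Turn k
  bob   : aliceRound k ≡ false → nA k ≡ suc (nB k) → suc (2 * nB k) ≡ k → Turn k

2*-suc : ∀ j → 2 * suc j ≡ suc (suc (2 * j))
2*-suc j = cong suc (ℕP.+-suc j (j + 0))

module _ {k : ℕ} where

  nA-alice : aliceRound k ≡ true → nA (suc k) ≡ suc (nA k)
  nA-alice ar rewrite ar = refl

  nA-bob : aliceRound k ≡ false → nA (suc k) ≡ nA k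
  nA-bob ar rewrite ar = refl

  nB-alice : aliceRound k ≡ true → nB (suc k) ≡ nB k
  nB-alice ar rewrite ar = refl

  nB-bob : aliceRound k ≡ false → nB (suc k) ≡ suc (nB k)
  nB-bob ar rewrite ar = refl

turn : ∀ k → Turn k
turn zero = alice refl refl refl
turn (suc k) with turn k
... | alice ar nA≡nB 2nA≡k =
  bob (cong not ar) (trans (nA-alice {k} ar) (cong suc (trans nA≡nB (sym (nB-alice {k} ar)))))
      (trans (cong (λ j → suc (2 * j)) (nB-alice {k} ar)) (cong suc (trans (cong (2 *_) (sym nA≡nB)) 2nA≡k)))
... | bob   ar nA≡ 2nB≡k =
  alice (cong not ar) (trans (nA-bob {k} ar) (trans nA≡ (sym (nB-bob {k} ar))))
        (trans (cong (2 *_) (trans (nA-bob {k} ar) nA≡)) (trans (2*-suc (nB k)) (cong suc 2nB≡k)))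

2*nA≤ : ∀ k → 2 * nA k ≤ suc k
2*nA≤ k with turn k
... | alice _ _ 2nA≡k = subst (_≤ suc k) (sym 2nA≡k) (ℕP.n≤1+n k)
... | bob _ nA≡ 2nB≡k = ℕP.≤-reflexive (trans (cong (2 *_) nA≡) (trans (2*-suc (nB k)) (cong suc 2nB≡k)))

2*nB≤ : ∀ k → 2 * nB k ≤ k
2*nB≤ k with turn k
... | alice _ nA≡nB 2nA≡k = ℕP.≤-reflexive (trans (cong (2 *_) (sym nA≡nB)) 2nA≡k)
... | bob _ _ 2nB≡k = subst (2 * nB k ≤_) 2nB≡k (ℕP.n≤1+n _)

mono-by-steps : (f : ℕ → ℕ) → (∀ k → f k ≤ f (suc k)) → ∀ {k K} → k ≤ K → f k ≤ f K
mono-by-steps f step k≤K = go (ℕP.≤⇒≤′ k≤K)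
  where
  go : ∀ {k K} → k ≤′ K → f k ≤ f K
  go ≤′-refl       = ℕP.≤-refl
  go (≤′-step k≤K) = ℕP.≤-trans (go k≤K) (step _)

nA-mono : ∀ {k K} → k ≤ K → nA k ≤ nA K
nA-mono = mono-by-steps nA step
  where
  step : ∀ k → nA k ≤ nA (suc k)
  step k with aliceRound k
  ... | true  = ℕP.n≤1+n _
  ... | false = ℕP.≤-refl

nB-mono : ∀ {k K} → k ≤ K → nB k ≤ nB K
nB-mono = mono-by-steps nB step
  where
  step : ∀ k → nB k ≤ nB (suc k)
  step k with aliceRound k
  ... | true  = ℕP.≤-refl
  ... | false = ℕP.n≤1+n _

module _ {A : Set} where

  length-∷ʳ : ∀ (xs : List A) x → length (xs ++ x ∷ []) ≡ suc (length xs)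
  length-∷ʳ []       x = refl
  length-∷ʳ (y ∷ xs) x = cong suc (length-∷ʳ xs x)

  take-++ˡ : ∀ n (xs ys : List A) → n ≤ length xs → take n (xs ++ ys) ≡ take n xs
  take-++ˡ zero    xs       ys _         = refl
  take-++ˡ (suc n) (x ∷ xs) ys (s≤s n≤) = cong (x ∷_) (take-++ˡ n xs ys n≤)

  take-++-length : ∀ n (xs ys : List A) → length xs ≡ n → take n (xs ++ ys) ≡ xs
  take-++-length n xs ys refl =
    trans (take-++ˡ n xs ys ℕP.≤-refl) (ListP.take-all n xs ℕP.≤-refl)

  nthOr : A → List A → ℕ → A
  nthOr d []       _       = d
  nthOr d (x ∷ xs) zero    = x
  nthOr d (x ∷ xs) (suc k) = nthOr d xs k

  nthOr-++ˡ : ∀ d k (xs ys : List A) → k < length xs → nthOr d (xs ++ ys) k ≡ nthOr d xs k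
  nthOr-++ˡ d zero    (x ∷ xs) ys _        = refl
  nthOr-++ˡ d (suc k) (x ∷ xs) ys (s≤s k<) = nthOr-++ˡ d k xs ys k<

  nthOr-∷ʳ : ∀ d k (xs : List A) x → length xs ≡ k → nthOr d (xs ++ x ∷ []) k ≡ x
  nthOr-∷ʳ d zero    []       x _   = refl
  nthOr-∷ʳ d (suc k) (y ∷ xs) x len = nthOr-∷ʳ d k xs x (ℕP.suc-injective len)

-- A party whose j-th query is made after it has seen the first off j messages
-- (off j = 2j for Alice, 2j+1 for Bob).
module Party {ℓ : ℕ} (qf : List (Str ℓ) → List Msg → Str ℓ) (off : ℕ → ℕ) where

  answers : Oracle ℓ → List Msg → ℕ → List (Str ℓ)
  answers H M zero    = []
  answers H M (suc j) = answers H M j ++ oracle H (qf (answers H M j) (take (off j) M)) ∷ []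

  length-answers : ∀ H M j → length (answers H M j) ≡ j
  length-answers H M zero    = refl
  length-answers H M (suc j) = trans (length-∷ʳ (answers H M j) _) (cong suc (length-answers H M j))

  take-answers : ∀ H M {j J} → j ≤ J → take j (answers H M J) ≡ answers H M j
  take-answers H M {j} {J} j≤J = go (ℕP.≤⇒≤′ j≤J)
    where
    go : ∀ {J} → j ≤′ J → take j (answers H M J) ≡ answers H M j
    go ≤′-refl = ListP.take-all j _ (ℕP.≤-reflexive (length-answers H M j))
    go (≤′-step {J} j≤′J) =
      trans (take-++ˡ j (answers H M J) _ (subst (j ≤_) (sym (length-answers H M J)) (ℕP.≤′⇒≤ j≤′J))) (go j≤′J)

  answers-++ : ∀ H M X j → (∀ i → i < j → off i ≤ length M) → answers H (M ++ X) j ≡ answers H M j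
  answers-++ H M X zero    _   = refl
  answers-++ H M X (suc j) fit =
    cong₂ (λ hs M′ → hs ++ oracle H (qf hs M′) ∷ [])
          (answers-++ H M X j (λ i i<j → fit i (ℕP.m≤n⇒m≤1+n i<j)))
          (take-++ˡ (off j) M X (fit j ℕP.≤-refl))

  -- Never returned: claims only looks up indices below the length of the list.
  claimsDefault : Str ℓ
  claimsDefault = replicate ℓ false

  claims : List (Str ℓ) → List Msg → Constraints ℓ
  claims hs M = map (λ j → (qf (take j hs) (take (off j) M) , nthOr claimsDefault hs j)) (upTo (length hs))

  claims-∷ʳ : ∀ hs x M → claims (hs ++ x ∷ []) M ≡ claims hs M ++ (qf hs (take (off (length hs)) M) , x) ∷ []
  claims-∷ʳ hs x M = begin
    map f′ (upTo (length (hs ++ x ∷ [])))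
      ≡⟨ cong (λ n → map f′ (upTo n)) (length-∷ʳ hs x) ⟩
    map f′ (upTo (suc J))
      ≡⟨ cong (map f′) (sym (ListP.upTo-∷ʳ J)) ⟩
    map f′ (upTo J ++ J ∷ [])
      ≡⟨ ListP.map-++ f′ (upTo J) (J ∷ []) ⟩
    map f′ (upTo J) ++ f′ J ∷ []
      ≡⟨ cong₂ _++_ (ListP.map-cong-local (All.tabulate (λ j∈ → f′≡f (∈-upTo⁻ j∈))))
                    (cong (_∷ []) (cong₂ _,_ (cong (λ hs′ → qf hs′ (take (off J) M)) (take-++-length J hs _ refl))
                                             (nthOr-∷ʳ claimsDefault J hs x refl))) ⟩
    claims hs M ++ (qf hs (take (off J) M) , x) ∷ [] ∎
    where
    open ≡-Reasoning
    J = length hs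
    f′ : ℕ → Str ℓ × Str ℓ
    f′ j = (qf (take j (hs ++ x ∷ [])) (take (off j) M) , nthOr claimsDefault (hs ++ x ∷ []) j)
    f′≡f : ∀ {j} → j < J → f′ j ≡ (qf (take j hs) (take (off j) M) , nthOr claimsDefault hs j)
    f′≡f {j} j<J = cong₂ _,_ (cong (λ hs′ → qf hs′ (take (off j) M)) (take-++ˡ j hs _ (ℕP.<⇒≤ j<J)))
                             (nthOr-++ˡ claimsDefault j hs _ j<J)

  consistent-claims-∷ʳ : ∀ H hs x M → consistent ℓ H (claims (hs ++ x ∷ []) M)
    ≡ consistent ℓ H (claims hs M) ∧ ((x ==S oracle H (qf hs (take (off (length hs)) M))) ∧ true)
  consistent-claims-∷ʳ H hs x M = trans (cong (consistent ℓ H) (claims-∷ʳ hs x M)) (consistent-++ ℓ H (claims hs M) _)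

  answers-consistent : ∀ H M J → T (consistent ℓ H (claims (answers H M J) M))
  answers-consistent H M zero    = tt
  answers-consistent H M (suc J) =
    subst T (sym (consistent-claims-∷ʳ H hs x M))
      (T-∧⁺ (answers-consistent H M J)
            (T-∧⁺ (does⁺ (VecP.≡-dec BoolP._≟_ x _)
                         (cong (λ n → oracle H (qf hs (take (off n) M))) (sym (length-answers H M J))))
                  tt))
    where
    hs = answers H M J
    x = oracle H (qf hs (take (off J) M))

  consistent⇒answers : ∀ H M J hs → length hs ≡ J → T (consistent ℓ H (claims hs M)) → hs ≡ answers H M J
  consistent⇒answers H M zero    []  _   _ = refl
  consistent⇒answers H M (suc J) hs len ok with initLast hs
  ... | hs′ ∷ʳ′ x with T-∧⁻ (subst T (consistent-claims-∷ʳ H hs′ x M) ok)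
  ...   | ok-hs′ , ok-x with consistent⇒answers H M J hs′ (ℕP.suc-injective (trans (sym (length-∷ʳ hs′ x)) len)) ok-hs′
  ...     | refl = cong (λ y → answers H M J ++ y ∷ [])
                        (trans (does⁻ (VecP.≡-dec BoolP._≟_ x _) (proj₁ (T-∧⁻ ok-x)))
                               (cong (λ n → oracle H (qf hs′ (take (off n) M))) (length-answers H M J)))

==M-refl : ∀ m → T (m ==M m)
==M-refl m = does⁺ (ListP.≡-dec BoolP._≟_ m m) refl

==M⇒≡ : ∀ {m m′} → T (m ==M m′) → m ≡ m′
==M⇒≡ {m} {m′} = does⁻ (ListP.≡-dec BoolP._≟_ m m′)

module Execution {ℓ ρa ρb : ℕ} (P : Protocol ℓ ρa ρb) where
  open Protocol P
  open Model P

  answersA : Vec Bool ρa → Oracle ℓ → List Msg → ℕ → List (Str ℓ)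
  answersA ra = Party.answers (queryA ra) (2 *_)

  answersB : Vec Bool ρb → Oracle ℓ → List Msg → ℕ → List (Str ℓ)
  answersB rb = Party.answers (queryB rb) (λ j → suc (2 * j))

  answersA-++ : ∀ ra H M X j → 2 * j ≤ 2 + length M → answersA ra H (M ++ X) j ≡ answersA ra H M j
  answersA-++ ra H M X j 2j≤ = Party.answers-++ (queryA ra) (2 *_) H M X j fit
    where
    fit : ∀ i → i < j → 2 * i ≤ length M
    fit i i<j = ℕP.≤-pred (ℕP.≤-pred (subst (_≤ 2 + length M) (2*-suc i) (ℕP.≤-trans (ℕP.*-monoʳ-≤ 2 i<j) 2j≤)))

  answersB-++ : ∀ rb H M X j → 2 * j ≤ suc (length M) → answersB rb H (M ++ X) j ≡ answersB rb H M j
  answersB-++ rb H M X j 2j≤ = Party.answers-++ (queryB rb) (λ i → suc (2 * i)) H M X j fit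
    where
    fit : ∀ i → i < j → suc (2 * i) ≤ length M
    fit i i<j = ℕP.≤-pred (subst (_≤ suc (length M)) (2*-suc i) (ℕP.≤-trans (ℕP.*-monoʳ-≤ 2 i<j) 2j≤))

  answersA-prefix : ∀ ra H M X {k} → k ≤ length M → answersA ra H (M ++ X) (nA k) ≡ answersA ra H M (nA k)
  answersA-prefix ra H M X {k} k≤M = answersA-++ ra H M X (nA k) (ℕP.≤-trans (2*nA≤ k) (ℕP.m≤n⇒m≤1+n (s≤s k≤M)))

  answersB-prefix : ∀ rb H M X {k} → k ≤ length M → answersB rb H (M ++ X) (nB k) ≡ answersB rb H M (nB k)
  answersB-prefix rb H M X {k} k≤M = answersB-++ rb H M X (nB k) (ℕP.≤-trans (2*nB≤ k) (ℕP.m≤n⇒m≤1+n k≤M))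

  aliceStep : Vec Bool ρa → Oracle ℓ → State → Msg × State
  aliceStep ra H (M , ha , hb) =
    let x = oracle H (queryA ra ha M)
        m = msgA ra (ha ++ x ∷ []) M
    in m , (M ++ m ∷ [] , ha ++ x ∷ [] , hb)

  bobStep : Vec Bool ρb → Oracle ℓ → State → Msg × State
  bobStep rb H (M , ha , hb) =
    let x = oracle H (queryB rb hb M)
        m = msgB rb (hb ++ x ∷ []) M
    in m , (M ++ m ∷ [] , ha , hb ++ x ∷ [])

  step-alice : ∀ ra rb H {k} s → aliceRound k ≡ true → step (ra , rb , H) k s ≡ aliceStep ra H s
  step-alice ra rb H {k} s ar rewrite ar = refl

  step-bob : ∀ ra rb H {k} s → aliceRound k ≡ false → step (ra , rb , H) k s ≡ bobStep rb H s
  step-bob ra rb H {k} s ar rewrite ar = refl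

  transcript : Ω → ℕ → List Msg
  transcript ω k = proj₁ (run ω k)

  StateInvariant : Vec Bool ρa → Vec Bool ρb → Oracle ℓ → ℕ → State → Set
  StateInvariant ra rb H k (M , ha , hb) =
    length M ≡ k × ha ≡ answersA ra H M (nA k) × hb ≡ answersB rb H M (nB k)

  aliceStep-invariant : ∀ ra rb H {k} s → aliceRound k ≡ true → 2 * nA k ≡ k →
    StateInvariant ra rb H k s → StateInvariant ra rb H (suc k) (proj₂ (aliceStep ra H s))
  aliceStep-invariant ra rb H {k} (M , ha , hb) ar 2nA≡k (len , refl , refl) =
      trans (length-∷ʳ M m) (cong suc len)
    , sym (trans (cong (answersA ra H M′) (nA-alice {k} ar))
                 (cong₂ (λ hs M″ → hs ++ oracle H (queryA ra hs M″) ∷ [])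
                        (answersA-prefix ra H M (m ∷ []) (ℕP.≤-reflexive (sym len)))
                        (take-++-length (2 * nA k) M (m ∷ []) (trans len (sym 2nA≡k)))))
    , sym (trans (cong (answersB rb H M′) (nB-alice {k} ar))
                 (answersB-prefix rb H M (m ∷ []) (ℕP.≤-reflexive (sym len))))
    where
    m = msgA ra (answersA ra H M (nA k) ++ oracle H (queryA ra (answersA ra H M (nA k)) M) ∷ []) M
    M′ = M ++ m ∷ []

  bobStep-invariant : ∀ ra rb H {k} s → aliceRound k ≡ false → suc (2 * nB k) ≡ k →
    StateInvariant ra rb H k s → StateInvariant ra rb H (suc k) (proj₂ (bobStep rb H s))
  bobStep-invariant ra rb H {k} (M , ha , hb) ar 2nB+1≡k (len , refl , refl) =
      trans (length-∷ʳ M m) (cong suc len)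
    , sym (trans (cong (answersA ra H M′) (nA-bob {k} ar))
                 (answersA-prefix ra H M (m ∷ []) (ℕP.≤-reflexive (sym len))))
    , sym (trans (cong (answersB rb H M′) (nB-bob {k} ar))
                 (cong₂ (λ hs M″ → hs ++ oracle H (queryB rb hs M″) ∷ [])
                        (answersB-prefix rb H M (m ∷ []) (ℕP.≤-reflexive (sym len)))
                        (take-++-length (suc (2 * nB k)) M (m ∷ []) (trans len (sym 2nB+1≡k)))))
    where
    m = msgB rb (answersB rb H M (nB k) ++ oracle H (queryB rb (answersB rb H M (nB k)) M) ∷ []) M
    M′ = M ++ m ∷ []

  run-invariant : ∀ ra rb H k → StateInvariant ra rb H k (run (ra , rb , H) k)
  run-invariant ra rb H zero = refl , refl , refl
  run-invariant ra rb H (suc k) with turn k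
  ... | alice ar _ 2nA≡k = subst (StateInvariant ra rb H (suc k)) (sym (cong proj₂ (step-alice ra rb H {k} s ar)))
                             (aliceStep-invariant ra rb H {k} s ar 2nA≡k (run-invariant ra rb H k))
    where s = run (ra , rb , H) k
  ... | bob ar _ 2nB+1≡k = subst (StateInvariant ra rb H (suc k)) (sym (cong proj₂ (step-bob ra rb H {k} s ar)))
                             (bobStep-invariant ra rb H {k} s ar 2nB+1≡k (run-invariant ra rb H k))
    where s = run (ra , rb , H) k

  length-viewA : ∀ ra rb H k → length (proj₂ (viewA (ra , rb , H) k)) ≡ nA k
  length-viewA ra rb H k =
    trans (cong length (proj₁ (proj₂ (run-invariant ra rb H k)))) (Party.length-answers _ _ H _ (nA k))

  length-viewB : ∀ ra rb H k → length (proj₂ (viewB (ra , rb , H) k)) ≡ nB k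
  length-viewB ra rb H k =
    trans (cong length (proj₂ (proj₂ (run-invariant ra rb H k)))) (Party.length-answers _ _ H _ (nB k))

  step-appends : ∀ ω k s → proj₁ (proj₂ (step ω k s)) ≡ proj₁ s ++ proj₁ (step ω k s) ∷ []
  step-appends (ra , rb , H) k s with aliceRound k
  ... | true  = refl
  ... | false = refl

  transcript-suc : ∀ ω k → transcript ω (suc k) ≡ transcript ω k ++ roundMsg ω k ∷ []
  transcript-suc ω k = step-appends ω k (run ω k)

  roundMsgOK : Vec Bool ρa → Vec Bool ρb → Oracle ℓ → List Msg → ℕ → Bool
  roundMsgOK ra rb H M k =
    if aliceRound k
    then nthOr [] M k ==M msgA ra (answersA ra H M (suc (nA k))) (take k M)
    else nthOr [] M k ==M msgB rb (answersB rb H M (suc (nB k))) (take k M)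

  messagesOK : Vec Bool ρa → Vec Bool ρb → Oracle ℓ → List Msg → ℕ → Bool
  messagesOK ra rb H M zero    = true
  messagesOK ra rb H M (suc k) = messagesOK ra rb H M k ∧ roundMsgOK ra rb H M k

  roundMsgOK-++ : ∀ ra rb H M X k → k < length M → roundMsgOK ra rb H (M ++ X) k ≡ roundMsgOK ra rb H M k
  roundMsgOK-++ ra rb H M X k k<M =
    cong₂ (if aliceRound k then_else_)
      (cong₂ _==M_ nth≡ (cong₂ (msgA ra) ansA≡ take≡))
      (cong₂ _==M_ nth≡ (cong₂ (msgB rb) ansB≡ take≡))
    where
    nth≡ = nthOr-++ˡ [] k M X k<M
    take≡ = take-++ˡ k M X (ℕP.<⇒≤ k<M)
    ansA≡ = answersA-++ ra H M X (suc (nA k))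
              (subst (_≤ 2 + length M) (sym (2*-suc (nA k))) (s≤s (s≤s (ℕP.≤-trans (2*nA≤ k) k<M))))
    ansB≡ = answersB-++ rb H M X (suc (nB k))
              (subst (_≤ suc (length M)) (sym (2*-suc (nB k))) (s≤s (ℕP.≤-trans (s≤s (2*nB≤ k)) k<M)))

  messagesOK-++ : ∀ ra rb H M X k → k ≤ length M → messagesOK ra rb H (M ++ X) k ≡ messagesOK ra rb H M k
  messagesOK-++ ra rb H M X zero    _   = refl
  messagesOK-++ ra rb H M X (suc k) k<M =
    cong₂ _∧_ (messagesOK-++ ra rb H M X k (ℕP.<⇒≤ k<M)) (roundMsgOK-++ ra rb H M X k k<M)

  roundMsgOK-run : ∀ ra rb H k m →
    roundMsgOK ra rb H (transcript (ra , rb , H) k ++ m ∷ []) k ≡ (m ==M roundMsg (ra , rb , H) k)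
  roundMsgOK-run ra rb H k m with run-invariant ra rb H k | turn k
  ... | len , ha≡ , _ | alice ar _ 2nA≡k rewrite ar =
    cong₂ _==M_ (nthOr-∷ʳ [] k M m len)
      (cong₂ (msgA ra) ans≡ (take-++-length k M _ len))
    where
    s = run (ra , rb , H) k
    M = proj₁ s
    ans≡ : answersA ra H (M ++ m ∷ []) (suc (nA k)) ≡ proj₁ (proj₂ s) ++ oracle H (queryA ra (proj₁ (proj₂ s)) M) ∷ []
    ans≡ = cong₂ (λ hs M′ → hs ++ oracle H (queryA ra hs M′) ∷ [])
             (trans (answersA-prefix ra H M _ (ℕP.≤-reflexive (sym len)))
                    (sym ha≡))
             (take-++-length (2 * nA k) M _ (trans len (sym 2nA≡k)))
  ... | len , _ , hb≡ | bob ar _ 2nB+1≡k rewrite ar =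
    cong₂ _==M_ (nthOr-∷ʳ [] k M m len)
      (cong₂ (msgB rb) ans≡ (take-++-length k M _ len))
    where
    s = run (ra , rb , H) k
    M = proj₁ s
    ans≡ : answersB rb H (M ++ m ∷ []) (suc (nB k)) ≡ proj₂ (proj₂ s) ++ oracle H (queryB rb (proj₂ (proj₂ s)) M) ∷ []
    ans≡ = cong₂ (λ hs M′ → hs ++ oracle H (queryB rb hs M′) ∷ [])
             (trans (answersB-prefix rb H M _ (ℕP.≤-reflexive (sym len)))
                    (sym hb≡))
             (take-++-length (suc (2 * nB k)) M _ (trans len (sym 2nB+1≡k)))

  transcript⇒messagesOK : ∀ ra rb H k → T (messagesOK ra rb H (transcript (ra , rb , H) k) k)
  transcript⇒messagesOK ra rb H zero    = tt
  transcript⇒messagesOK ra rb H (suc k) =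
    subst (λ M → T (messagesOK ra rb H M (suc k))) (sym (transcript-suc ω k))
      (T-∧⁺ (subst T (sym (messagesOK-++ ra rb H M _ k (ℕP.≤-reflexive (sym (proj₁ (run-invariant ra rb H k))))))
                     (transcript⇒messagesOK ra rb H k))
            (subst T (sym (roundMsgOK-run ra rb H k m)) (==M-refl m)))
    where
    ω = (ra , rb , H)
    M = transcript ω k
    m = roundMsg ω k

  messagesOK⇒transcript : ∀ ra rb H k M → length M ≡ k → T (messagesOK ra rb H M k) → transcript (ra , rb , H) k ≡ M
  messagesOK⇒transcript ra rb H zero    []  _   _  = refl
  messagesOK⇒transcript ra rb H (suc k) M   len ok with initLast M
  ... | M′ ∷ʳ′ m with T-∧⁻ ok
  ...   | ok-M′ , ok-m with messagesOK⇒transcript ra rb H k M′ len′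
                              (subst T (messagesOK-++ ra rb H M′ _ k (ℕP.≤-reflexive (sym len′))) ok-M′)
    where len′ = ℕP.suc-injective (trans (sym (length-∷ʳ M′ m)) len)
  ...     | refl = trans (transcript-suc (ra , rb , H) k)
                         (cong (λ m′ → M′ ++ m′ ∷ []) (sym (==M⇒≡ (subst T (roundMsgOK-run ra rb H k m) ok-m))))

  sentByA : Vec Bool ρa → List (Str ℓ) → List Msg → ℕ → Bool
  sentByA ra ha M zero    = true
  sentByA ra ha M (suc k) = sentByA ra ha M k ∧
    (if aliceRound k then nthOr [] M k ==M msgA ra (take (suc (nA k)) ha) (take k M) else true)

  sentByB : Vec Bool ρb → List (Str ℓ) → List Msg → ℕ → Bool
  sentByB rb hb M zero    = true
  sentByB rb hb M (suc k) = sentByB rb hb M k ∧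
    (if aliceRound k then true else nthOr [] M k ==M msgB rb (take (suc (nB k)) hb) (take k M))

  -- Each message depends only on its sender's answers, so the transcript check splits
  -- into a condition on Alice's view and one on Bob's.
  messagesOK-split : ∀ ra rb H M {K} k → k ≤ K →
    messagesOK ra rb H M k ≡ sentByA ra (answersA ra H M (nA K)) M k ∧ sentByB rb (answersB rb H M (nB K)) M k
  messagesOK-split ra rb H M zero    _   = refl
  messagesOK-split ra rb H M {K} (suc k) k<K with turn k
  ... | alice ar _ _ rewrite ar =
    trans (cong (_∧ _) (messagesOK-split ra rb H M k (ℕP.<⇒≤ k<K)))
          (trans (cong (λ hs → (sentByA ra hsA M k ∧ sentByB rb hsB M k) ∧ (nthOr [] M k ==M msgA ra hs (take k M)))
                       (sym (Party.take-answers (queryA ra) (2 *_) H M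
                              (subst (_≤ nA K) (nA-alice {k} ar) (nA-mono k<K)))))
                 (∧-interchange-true (sentByA ra hsA M k) (sentByB rb hsB M k) _))
    where
    hsA = answersA ra H M (nA K)
    hsB = answersB rb H M (nB K)
    ∧-interchange-true : ∀ a b x → (a ∧ b) ∧ x ≡ (a ∧ x) ∧ (b ∧ true)
    ∧-interchange-true true  b x = trans (BoolP.∧-comm b x) (cong (x ∧_) (sym (BoolP.∧-identityʳ b)))
    ∧-interchange-true false b x = refl
  ... | bob ar _ _ rewrite ar =
    trans (cong (_∧ _) (messagesOK-split ra rb H M k (ℕP.<⇒≤ k<K)))
          (trans (cong (λ hs → (sentByA ra hsA M k ∧ sentByB rb hsB M k) ∧ (nthOr [] M k ==M msgB rb hs (take k M)))
                       (sym (Party.take-answers (queryB rb) (λ j → suc (2 * j)) H M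
                              (subst (_≤ nB K) (nB-bob {k} ar) (nB-mono k<K)))))
                 (trans (BoolP.∧-assoc (sentByA ra hsA M k) (sentByB rb hsB M k) _)
                        (cong (_∧ _) (sym (BoolP.∧-identityʳ (sentByA ra hsA M k))))))
    where
    hsA = answersA ra H M (nA K)
    hsB = answersB rb H M (nB K)

  claimsA : ViewA → List Msg → Constraints ℓ
  claimsA (ra , ha) = Party.claims (queryA ra) (2 *_) ha

  claimsB : ViewB → List Msg → Constraints ℓ
  claimsB (rb , hb) = Party.claims (queryB rb) (λ j → suc (2 * j)) hb

  queriesOf-claimsA : ∀ a M → queriesOf (claimsA a M) ≡ queriesA a M
  queriesOf-claimsA (ra , ha) M = sym (ListP.map-∘ (upTo (length ha)))

  queriesOf-claimsB : ∀ b M → queriesOf (claimsB b M) ≡ queriesB b M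
  queriesOf-claimsB (rb , hb) M = sym (ListP.map-∘ (upTo (length hb)))

  wellFormedA : List Msg → ViewA → Bool
  wellFormedA M (ra , ha) = does (length ha ℕP.≟ nA (length M)) ∧ sentByA ra ha M (length M)

  wellFormedB : List Msg → ViewB → Bool
  wellFormedB M (rb , hb) = does (length hb ℕP.≟ nB (length M)) ∧ sentByB rb hb M (length M)

  LocallyConsistent : Oracle ℓ → List Msg → ViewA → ViewB → Set
  LocallyConsistent H M a b =
    T (wellFormedA M a) × T (wellFormedB M b) × T (consistent ℓ H (claimsA a M)) × T (consistent ℓ H (claimsB b M))

  run⇒locallyConsistent : ∀ ra rb H M → transcript (ra , rb , H) (length M) ≡ M →
    let ω = (ra , rb , H) in LocallyConsistent H M (viewA ω (length M)) (viewB ω (length M))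
  run⇒locallyConsistent ra rb H M tr≡M =
      T-∧⁺ (does⁺ (length ha ℕP.≟ nA k) (trans (cong length ha≡) (Party.length-answers _ _ H M (nA k))))
           (subst (λ hs → T (sentByA ra hs M k)) (sym ha≡) (proj₁ (T-∧⁻ sent)))
    , T-∧⁺ (does⁺ (length hb ℕP.≟ nB k) (trans (cong length hb≡) (Party.length-answers _ _ H M (nB k))))
           (subst (λ hs → T (sentByB rb hs M k)) (sym hb≡) (proj₂ (T-∧⁻ sent)))
    , subst (λ hs → T (consistent ℓ H (claimsA (ra , hs) M))) (sym ha≡) (Party.answers-consistent _ _ H M (nA k))
    , subst (λ hs → T (consistent ℓ H (claimsB (rb , hs) M))) (sym hb≡) (Party.answers-consistent _ _ H M (nB k))
    where
    k = length M
    s = run (ra , rb , H) k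
    ha = proj₁ (proj₂ s)
    hb = proj₂ (proj₂ s)
    ha≡ : ha ≡ answersA ra H M (nA k)
    ha≡ = trans (proj₁ (proj₂ (run-invariant ra rb H k))) (cong (λ M′ → answersA ra H M′ (nA k)) tr≡M)
    hb≡ : hb ≡ answersB rb H M (nB k)
    hb≡ = trans (proj₂ (proj₂ (run-invariant ra rb H k))) (cong (λ M′ → answersB rb H M′ (nB k)) tr≡M)
    sent : T (sentByA ra (answersA ra H M (nA k)) M k ∧ sentByB rb (answersB rb H M (nB k)) M k)
    sent = subst T (messagesOK-split ra rb H M k ℕP.≤-refl)
                 (subst (λ M′ → T (messagesOK ra rb H M′ k)) tr≡M (transcript⇒messagesOK ra rb H k))

  locallyConsistent⇒run : ∀ ra rb H M ha hb → LocallyConsistent H M (ra , ha) (rb , hb) →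
    let ω = (ra , rb , H) in
    transcript ω (length M) ≡ M × viewA ω (length M) ≡ (ra , ha) × viewB ω (length M) ≡ (rb , hb)
  locallyConsistent⇒run ra rb H M ha hb (wfA , wfB , okA , okB) =
      tr≡M
    , cong (ra ,_) (trans (trans (proj₁ (proj₂ inv)) (cong (λ M′ → answersA ra H M′ (nA k)) tr≡M)) (sym ha≡))
    , cong (rb ,_) (trans (trans (proj₂ (proj₂ inv)) (cong (λ M′ → answersB rb H M′ (nB k)) tr≡M)) (sym hb≡))
    where
    k = length M
    inv = run-invariant ra rb H k
    lenA = proj₁ (T-∧⁻ wfA)
    sentA = proj₂ (T-∧⁻ wfA)
    lenB = proj₁ (T-∧⁻ wfB)
    sentB = proj₂ (T-∧⁻ wfB)
    ha≡ : ha ≡ answersA ra H M (nA k)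
    ha≡ = Party.consistent⇒answers _ _ H M (nA k) ha (does⁻ (length ha ℕP.≟ nA k) lenA) okA
    hb≡ : hb ≡ answersB rb H M (nB k)
    hb≡ = Party.consistent⇒answers _ _ H M (nB k) hb (does⁻ (length hb ℕP.≟ nB k) lenB) okB
    tr≡M : transcript (ra , rb , H) k ≡ M
    tr≡M = messagesOK⇒transcript ra rb H k M refl
             (subst T (sym (messagesOK-split ra rb H M k ℕP.≤-refl))
               (T-∧⁺ (subst (λ hs → T (sentByA ra hs M k)) ha≡ sentA) (subst (λ hs → T (sentByB rb hs M k)) hb≡ sentB)))

module _ where
  open import Data.Nat.Coprimality using (1-coprimeTo)
  import Data.Nat.Coprimality as Coprimality
  open import Data.Integer using (+_)
  import Data.Integer as ℤ
  import Data.Integer.Properties as ℤP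
  open import Data.Rational using (mkℚ)

  toℚ≡mkℚ : ∀ a → toℚ a ≡ mkℚ (+ a) 0 (Coprimality.sym (1-coprimeTo a))
  toℚ≡mkℚ a = ℚP.normalize-coprime (Coprimality.sym (1-coprimeTo a))

  toℚ-+ : ∀ a b → toℚ (a + b) ≡ toℚ a ℚ.+ toℚ b
  toℚ-+ a b = sym (trans (cong₂ ℚ._+_ (toℚ≡mkℚ a) (toℚ≡mkℚ b))
    (ℚP./-cong {p₁ = (+ a) ℤ.* (+ 1) ℤ.+ (+ b) ℤ.* (+ 1)} {q₁ = 1} {p₂ = + (a + b)} {q₂ = 1}
      (trans (cong₂ ℤ._+_ (ℤP.*-identityʳ (+ a)) (ℤP.*-identityʳ (+ b))) (sym (ℤP.pos-+ a b))) refl))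

  toℚ-* : ∀ a b → toℚ (a * b) ≡ toℚ a ℚ.* toℚ b
  toℚ-* a b = sym (trans (cong₂ ℚ._*_ (toℚ≡mkℚ a) (toℚ≡mkℚ b))
    (ℚP./-cong {p₁ = (+ a) ℤ.* (+ b)} {q₁ = 1} {p₂ = + (a * b)} {q₂ = 1} (sym (ℤP.pos-* a b)) refl))

indℚ≡toℚ-ind : ∀ b → indℚ b ≡ toℚ (ind b)
indℚ≡toℚ-ind true  = refl
indℚ≡toℚ-ind false = refl

toℚ-pos : ∀ a → 0 < a → ℚ.Positive (toℚ a)
toℚ-pos (suc a) _ = ℚP.normalize-pos (suc a) 1

toℚ-nonNeg : ∀ a → ℚ.NonNegative (toℚ a)
toℚ-nonNeg a = ℚP.normalize-nonNeg a 1

sumℚ-cong : {A : Set} {f g : A → ℚ} → (∀ x → f x ≡ g x) → ∀ xs → sumℚ (map f xs) ≡ sumℚ (map g xs)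
sumℚ-cong e []       = refl
sumℚ-cong e (x ∷ xs) = cong₂ ℚ._+_ (e x) (sumℚ-cong e xs)

sumℚ-toℚ-*ʳ : {A : Set} (f : A → ℕ) (c : ℚ) → ∀ xs →
  sumℚ (map (λ x → toℚ (f x) ℚ.* c) xs) ≡ toℚ (sumMap f xs) ℚ.* c
sumℚ-toℚ-*ʳ f c []       = sym (ℚP.*-zeroˡ c)
sumℚ-toℚ-*ʳ f c (x ∷ xs) =
  trans (cong (toℚ (f x) ℚ.* c ℚ.+_) (sumℚ-toℚ-*ʳ f c xs))
  (trans (sym (ℚP.*-distribʳ-+ c (toℚ (f x)) (toℚ (sumMap f xs))))
         (cong (ℚ._* c) (sym (toℚ-+ (f x) (sumMap f xs)))))

module Normalise {X : Set} {supp : List X} (F : X → ℕ) (F-outside : ∀ x → x ∉ supp → F x ≡ 0)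
                 (total-pos : 0 < sumMap F supp) where

  private
    total-positive : ℚ.Positive (toℚ (sumMap F supp))
    total-positive = toℚ-pos (sumMap F supp) total-pos

    instance
      total-nonZero : ℚ.NonZero (toℚ (sumMap F supp))
      total-nonZero = ℚP.pos⇒nonZero (toℚ (sumMap F supp)) {{total-positive}}

  factor : ℚ
  factor = ℚ.1/ toℚ (sumMap F supp)

  factor-positive : ℚ.Positive factor
  factor-positive = ℚP.1/pos⇒pos (toℚ (sumMap F supp)) {{total-positive}}

  dist : Dist supp
  dist = record
    { weight  = λ x → toℚ (F x) ℚ.* factor
    ; nonneg  = λ x → ℚP.nonNegative⁻¹ (toℚ (F x) ℚ.* factor)
                          {{ℚP.nonNeg*nonNeg⇒nonNeg (toℚ (F x)) {{toℚ-nonNeg (F x)}}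
                                                    factor {{ℚP.pos⇒nonNeg factor {{factor-positive}}}}}}
    ; outside = λ x x∉ → trans (cong (λ w → toℚ w ℚ.* factor) (F-outside x x∉)) (ℚP.*-zeroˡ factor)
    ; total   = trans (sumℚ-toℚ-*ʳ F factor supp) (ℚP.*-inverseʳ (toℚ (sumMap F supp)))
    }

toℚ-rescale : ∀ c N NI w S (f : ℚ) → S ≡ N * NI → c * NI ≡ w →
  toℚ c ℚ.* (toℚ S ℚ.* f) ≡ toℚ N ℚ.* (toℚ w ℚ.* f)
toℚ-rescale c N NI w S f refl cNI≡w = begin
  toℚ c ℚ.* (toℚ (N * NI) ℚ.* f)   ≡⟨ sym (ℚP.*-assoc (toℚ c) _ f) ⟩
  toℚ c ℚ.* toℚ (N * NI) ℚ.* f     ≡⟨ cong (ℚ._* f) (sym (toℚ-* c (N * NI))) ⟩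
  toℚ (c * (N * NI)) ℚ.* f         ≡⟨ cong (λ x → toℚ x ℚ.* f) (trans (swap c N NI) (cong (N *_) cNI≡w)) ⟩
  toℚ (N * w) ℚ.* f                ≡⟨ cong (ℚ._* f) (toℚ-* N w) ⟩
  toℚ N ℚ.* toℚ w ℚ.* f            ≡⟨ ℚP.*-assoc (toℚ N) (toℚ w) f ⟩
  toℚ N ℚ.* (toℚ w ℚ.* f) ∎
  where
  open ≡-Reasoning
  swap : ∀ x y z → x * (y * z) ≡ y * (x * z)
  swap = CommSemigroupP.x∙yz≈y∙xz ℕP.*-commutativeSemigroup

module NormalisedProduct {X Y : Set} {xs : List X} {ys : List Y}
    (F : X → ℕ) (F-outside : ∀ x → x ∉ xs → F x ≡ 0) (F-total-pos : 0 < sumMap F xs)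
    (G : Y → ℕ) (G-outside : ∀ y → y ∉ ys → G y ≡ 0) (G-total-pos : 0 < sumMap G ys)
    (g : X → Y → Bool) where

  module 𝒜 = Normalise F F-outside F-total-pos
  module ℬ = Normalise G G-outside G-total-pos

  factor : ℚ
  factor = 𝒜.factor ℚ.* ℬ.factor

  factor-positive : ℚ.Positive factor
  factor-positive = ℚP.pos*pos⇒pos 𝒜.factor {{𝒜.factor-positive}} ℬ.factor {{ℬ.factor-positive}}

  product-weight : ∀ a b → weight 𝒜.dist a ℚ.* weight ℬ.dist b ℚ.* indℚ (g a b)
                           ≡ toℚ (ind (g a b) * (F a * G b)) ℚ.* factor
  product-weight a b = begin
    (toℚ (F a) ℚ.* 𝒜.factor) ℚ.* (toℚ (G b) ℚ.* ℬ.factor) ℚ.* indℚ (g a b)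
      ≡⟨ cong (toℚ (F a) ℚ.* 𝒜.factor ℚ.* (toℚ (G b) ℚ.* ℬ.factor) ℚ.*_) (indℚ≡toℚ-ind (g a b)) ⟩
    (toℚ (F a) ℚ.* 𝒜.factor) ℚ.* (toℚ (G b) ℚ.* ℬ.factor) ℚ.* toℚ (ind (g a b))
      ≡⟨ rearrange (toℚ (F a)) 𝒜.factor (toℚ (G b)) ℬ.factor (toℚ (ind (g a b))) ⟩
    (toℚ (ind (g a b)) ℚ.* (toℚ (F a) ℚ.* toℚ (G b))) ℚ.* factor
      ≡⟨ cong (ℚ._* factor) (sym (trans (toℚ-* (ind (g a b)) (F a * G b))
                                        (cong (toℚ (ind (g a b)) ℚ.*_) (toℚ-* (F a) (G b))))) ⟩
    toℚ (ind (g a b) * (F a * G b)) ℚ.* factor ∎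
    where
    open ≡-Reasoning
    open import Data.Rational.Solver using (module +-*-Solver)
    open +-*-Solver
    rearrange : ∀ x i y j z → (x ℚ.* i) ℚ.* (y ℚ.* j) ℚ.* z ≡ (z ℚ.* (x ℚ.* y)) ℚ.* (i ℚ.* j)
    rearrange = solve 5 (λ x i y j z → (x :* i) :* (y :* j) :* z := (z :* (x :* y)) :* (i :* j)) refl

  sum-product-weight :
    sumℚ (map (λ a → sumℚ (map (λ b → weight 𝒜.dist a ℚ.* weight ℬ.dist b ℚ.* indℚ (g a b)) ys)) xs)
      ≡ toℚ (sumMap (λ a → sumMap (λ b → ind (g a b) * (F a * G b)) ys) xs) ℚ.* factor
  sum-product-weight =
    trans (sumℚ-cong (λ a → trans (sumℚ-cong (product-weight a) ys)
                                  (sumℚ-toℚ-*ʳ (λ b → ind (g a b) * (F a * G b)) factor ys)) xs)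
          (sumℚ-toℚ-*ʳ (λ a → sumMap (λ b → ind (g a b) * (F a * G b)) ys) factor xs)

module Conditioning {ℓ ρa ρb : ℕ} (P : Protocol ℓ ρa ρb) (n : ℕ) (ε : ℚ) where
  open Model P
  open Eve n ε
  open Execution P

  -- The part of reach that does not depend on the sample.
  eveFollowsStrategy : History ℓ → Bool
  eveFollowsStrategy []             = true
  eveFollowsStrategy (msgE m ∷ h)   = eveFollowsStrategy h ∧ (isNothing (eveNext h) ∧ (length (msgsOf h) <ᵇ 2 * n))
  eveFollowsStrategy (qryE q a ∷ h) = eveFollowsStrategy h ∧ isJust≡ (eveNext h) q

  oracleOf : Ω → Oracle ℓ
  oracleOf (_ , _ , H) = H

  transcript-∷ʳ : ∀ ω (M : List Msg) (m : Msg) →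
    transcript ω (length (M ++ m ∷ [])) ≡ transcript ω (length M) ++ roundMsg ω (length M) ∷ []
  transcript-∷ʳ ω M m = trans (cong (transcript ω) (length-∷ʳ M m)) (transcript-suc ω (length M))

  consistent-∷ʳ : ∀ H (I : Constraints ℓ) q a →
    consistent ℓ H (I ++ (q , a) ∷ []) ≡ consistent ℓ H I ∧ ((a ==S oracle H q) ∧ true)
  consistent-∷ʳ H I q a = consistent-++ ℓ H I _

  reach⇒ : ∀ ω h → T (reach ω h) →
    T (eveFollowsStrategy h) × transcript ω (length (msgsOf h)) ≡ msgsOf h × T (consistent ℓ (oracleOf ω) (infoOf h))
  reach⇒ ω [] _ = tt , refl , tt
  reach⇒ ω (msgE m ∷ h) r =
      T-∧⁺ {eveFollowsStrategy h} {waits ∧ inTime} follows (T-∧⁺ {waits} {inTime} waits? inTime?)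
    , trans (transcript-∷ʳ ω (msgsOf h) m)
            (cong₂ (λ M m′ → M ++ m′ ∷ []) tr≡ (sym (==M⇒≡ {m} {roundMsg ω (length (msgsOf h))} m?)))
    , ok
    where
    waits = isNothing (eveNext h)
    inTime = length (msgsOf h) <ᵇ 2 * n
    sent = m ==M roundMsg ω (length (msgsOf h))
    r-h = proj₁ (T-∧⁻ {reach ω h} {waits ∧ (inTime ∧ sent)} r)
    r-m = proj₂ (T-∧⁻ {reach ω h} {waits ∧ (inTime ∧ sent)} r)
    waits? = proj₁ (T-∧⁻ {waits} {inTime ∧ sent} r-m)
    inTime? = proj₁ (T-∧⁻ {inTime} {sent} (proj₂ (T-∧⁻ {waits} {inTime ∧ sent} r-m)))
    m? = proj₂ (T-∧⁻ {inTime} {sent} (proj₂ (T-∧⁻ {waits} {inTime ∧ sent} r-m)))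
    ih = reach⇒ ω h r-h
    follows = proj₁ ih
    tr≡ = proj₁ (proj₂ ih)
    ok = proj₂ (proj₂ ih)
  reach⇒ ω (qryE q a ∷ h) r =
      T-∧⁺ {eveFollowsStrategy h} {queried} follows queried?
    , tr≡
    , subst T (sym (consistent-∷ʳ (oracleOf ω) (infoOf h) q a))
              (T-∧⁺ {consistent ℓ (oracleOf ω) (infoOf h)} ok (T-∧⁺ {answered} a? tt))
    where
    queried = isJust≡ (eveNext h) q
    answered = a ==S oracle (oracleOf ω) q
    r-h = proj₁ (T-∧⁻ {reach ω h} {queried ∧ answered} r)
    r-q = proj₂ (T-∧⁻ {reach ω h} {queried ∧ answered} r)
    queried? = proj₁ (T-∧⁻ {queried} {answered} r-q)
    a? = proj₂ (T-∧⁻ {queried} {answered} r-q)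
    ih = reach⇒ ω h r-h
    follows = proj₁ ih
    tr≡ = proj₁ (proj₂ ih)
    ok = proj₂ (proj₂ ih)

  reach⇐ : ∀ ω h → T (eveFollowsStrategy h) → transcript ω (length (msgsOf h)) ≡ msgsOf h →
    T (consistent ℓ (oracleOf ω) (infoOf h)) → T (reach ω h)
  reach⇐ ω [] _ _ _ = tt
  reach⇐ ω (msgE m ∷ h) f tr≡ ok =
    T-∧⁺ {reach ω h} {waits ∧ (inTime ∧ sent)} (reach⇐ ω h follows (proj₁ split) ok)
      (T-∧⁺ {waits} {inTime ∧ sent} waits?
        (T-∧⁺ {inTime} {sent} inTime? (does⁺ (ListP.≡-dec BoolP._≟_ m _) (sym (proj₂ split)))))
    where
    waits = isNothing (eveNext h)
    inTime = length (msgsOf h) <ᵇ 2 * n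
    sent = m ==M roundMsg ω (length (msgsOf h))
    follows = proj₁ (T-∧⁻ {eveFollowsStrategy h} {waits ∧ inTime} f)
    waits? = proj₁ (T-∧⁻ {waits} {inTime} (proj₂ (T-∧⁻ {eveFollowsStrategy h} {waits ∧ inTime} f)))
    inTime? = proj₂ (T-∧⁻ {waits} {inTime} (proj₂ (T-∧⁻ {eveFollowsStrategy h} {waits ∧ inTime} f)))
    split = ListP.∷ʳ-injective (transcript ω (length (msgsOf h))) (msgsOf h)
              (trans (sym (transcript-∷ʳ ω (msgsOf h) m)) tr≡)
  reach⇐ ω (qryE q a ∷ h) f tr≡ ok =
    T-∧⁺ {reach ω h} {queried ∧ answered} (reach⇐ ω h follows tr≡ ok-h) (T-∧⁺ {queried} {answered} queried? a?)
    where
    queried = isJust≡ (eveNext h) q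
    answered = a ==S oracle (oracleOf ω) q
    follows = proj₁ (T-∧⁻ {eveFollowsStrategy h} {queried} f)
    queried? = proj₂ (T-∧⁻ {eveFollowsStrategy h} {queried} f)
    ok′ = T-∧⁻ {consistent ℓ (oracleOf ω) (infoOf h)} {answered ∧ true}
            (subst T (consistent-∷ʳ (oracleOf ω) (infoOf h) q a) ok)
    ok-h = proj₁ ok′
    a? = proj₁ (T-∧⁻ {answered} {true} (proj₂ ok′))

  module AtHistory (h : History ℓ) where

    M : List Msg
    M = msgsOf h

    k : ℕ
    k = length M

    I : Constraints ℓ
    I = infoOf h

    admissible : ViewA → ViewB → Bool
    admissible a b = eveFollowsStrategy h ∧ (goodV M I a b ∧ (wellFormedA M a ∧ wellFormedB M b))

    jointClaims : ViewA → ViewB → Constraints ℓ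
    jointClaims a b = claimsA a M ++ claimsB b M ++ I

    generates : ViewA → ViewB → Ω → Bool
    generates a b ω =
      does (VecP.≡-dec BoolP._≟_ (proj₁ a) (proj₁ ω)) ∧
      (does (VecP.≡-dec BoolP._≟_ (proj₁ b) (proj₁ (proj₂ ω))) ∧ consistent ℓ (oracleOf ω) (jointClaims a b))

    consistent-jointClaims : ∀ H a b →
      consistent ℓ H (jointClaims a b) ≡ consistent ℓ H (claimsA a M) ∧ (consistent ℓ H (claimsB b M) ∧ consistent ℓ H I)
    consistent-jointClaims H a b =
      trans (consistent-++ ℓ H (claimsA a M) _) (cong (consistent ℓ H (claimsA a M) ∧_) (consistent-++ ℓ H (claimsB b M) I))

    reaching⇒admissible : ∀ ra rb H → let ω = (ra , rb , H) ; a = viewA ω k ; b = viewB ω k in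
      T (reach ω h) → T (goodV M I a b) → T (admissible a b ∧ generates a b ω)
    reaching⇒admissible ra rb H r good =
      T-∧⁺ {admissible a b} {generates a b ω}
        (T-∧⁺ {eveFollowsStrategy h} follows (T-∧⁺ {goodV M I a b} good (T-∧⁺ {wellFormedA M a} wfA wfB)))
        (T-∧⁺ (does⁺ (VecP.≡-dec BoolP._≟_ ra ra) refl)
          (T-∧⁺ (does⁺ (VecP.≡-dec BoolP._≟_ rb rb) refl)
            (subst T (sym (consistent-jointClaims H a b))
              (T-∧⁺ {consistent ℓ H (claimsA a M)} okA (T-∧⁺ {consistent ℓ H (claimsB b M)} okB okI)))))
      where
      ω = (ra , rb , H)
      a = viewA ω k
      b = viewB ω k
      reached = reach⇒ ω h r
      follows = proj₁ reached
      okI = proj₂ (proj₂ reached)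
      local = run⇒locallyConsistent ra rb H M (proj₁ (proj₂ reached))
      wfA = proj₁ local
      wfB = proj₁ (proj₂ local)
      okA = proj₁ (proj₂ (proj₂ local))
      okB = proj₂ (proj₂ (proj₂ local))

    reachesWith : ViewA → ViewB → Ω → Bool
    reachesWith a b ω = goodAt h ω ∧ (viewA ω k ==VA a) ∧ (viewB ω k ==VB b)

    admissible⇒reaching : ∀ ra rb H ha hb → let a = (ra , ha) ; b = (rb , hb) in
      T (admissible a b) → T (consistent ℓ H (jointClaims a b)) → T (reachesWith a b (ra , rb , H))
    admissible⇒reaching ra rb H ha hb adm ok =
      T-∧⁺ {goodAt h ω} {(viewA ω k ==VA a) ∧ (viewB ω k ==VB b)}
        (T-∧⁺ {reach ω h} {goodV M I (viewA ω k) (viewB ω k)}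
          (reach⇐ ω h follows tr≡M okI)
          (subst₂ (λ a′ b′ → T (goodV M I a′ b′)) (sym vA≡) (sym vB≡) good))
        (T-∧⁺ {viewA ω k ==VA a} {viewB ω k ==VB b} (does⁺ (viewA ω k ≟View a) vA≡) (does⁺ (viewB ω k ≟View b) vB≡))
      where
      ω = (ra , rb , H)
      a = (ra , ha)
      b = (rb , hb)
      adm₁ = T-∧⁻ {eveFollowsStrategy h} {goodV M I a b ∧ (wellFormedA M a ∧ wellFormedB M b)} adm
      follows = proj₁ adm₁
      adm₂ = T-∧⁻ {goodV M I a b} {wellFormedA M a ∧ wellFormedB M b} (proj₂ adm₁)
      good = proj₁ adm₂
      wf = T-∧⁻ {wellFormedA M a} {wellFormedB M b} (proj₂ adm₂)
      ok₁ = T-∧⁻ {consistent ℓ H (claimsA a M)} {consistent ℓ H (claimsB b M) ∧ consistent ℓ H I}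
              (subst T (consistent-jointClaims H a b) ok)
      ok₂ = T-∧⁻ {consistent ℓ H (claimsB b M)} {consistent ℓ H I} (proj₂ ok₁)
      okI = proj₂ ok₂
      run≡ = locallyConsistent⇒run ra rb H M ha hb (proj₁ wf , proj₂ wf , proj₁ ok₁ , proj₁ ok₂)
      tr≡M = proj₁ run≡
      vA≡ = proj₁ (proj₂ run≡)
      vB≡ = proj₂ (proj₂ run≡)

    reachesWith≡ : ∀ a b ω → reachesWith a b ω ≡ admissible a b ∧ generates a b ω
    reachesWith≡ a@(ra′ , ha) b@(rb′ , hb) ω@(ra , rb , H) = T-injective to from
      where
      to : T (reachesWith a b ω) → T (admissible a b ∧ generates a b ω)
      to t = subst₂ (λ a′ b′ → T (admissible a′ b′ ∧ generates a′ b′ ω))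
                    (does⁻ (viewA ω k ≟View a) (proj₁ sameViews)) (does⁻ (viewB ω k ≟View b) (proj₂ sameViews))
                    (reaching⇒admissible ra rb H (proj₁ reached) (proj₂ reached))
        where
        t₁ = T-∧⁻ {goodAt h ω} {(viewA ω k ==VA a) ∧ (viewB ω k ==VB b)} t
        reached = T-∧⁻ {reach ω h} {goodV M I (viewA ω k) (viewB ω k)} (proj₁ t₁)
        sameViews = T-∧⁻ {viewA ω k ==VA a} {viewB ω k ==VB b} (proj₂ t₁)
      from : T (admissible a b ∧ generates a b ω) → T (reachesWith a b ω)
      from t = subst₂ (λ r r′ → T (reachesWith (r , ha) (r′ , hb) ω)) (sym ra≡) (sym rb≡)
                 (admissible⇒reaching ra rb H ha hb
                   (subst₂ (λ r r′ → T (admissible (r , ha) (r′ , hb))) ra≡ rb≡ adm)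
                   (subst₂ (λ r r′ → T (consistent ℓ H (jointClaims (r , ha) (r′ , hb)))) ra≡ rb≡ (proj₂ gen₂)))
        where
        t₁ = T-∧⁻ {admissible a b} {generates a b ω} t
        adm = proj₁ t₁
        gen₁ = T-∧⁻ (proj₂ t₁)
        gen₂ = T-∧⁻ (proj₂ gen₁)
        ra≡ : ra′ ≡ ra
        ra≡ = does⁻ (VecP.≡-dec BoolP._≟_ ra′ ra) (proj₁ gen₁)
        rb≡ : rb′ ≡ rb
        rb≡ = does⁻ (VecP.≡-dec BoolP._≟_ rb′ rb) (proj₁ gen₂)

    countAB≡ : ∀ a b → countAB h a b ≡ ind (admissible a b) * #consistent ℓ (jointClaims a b)
    countAB≡ a@(ra , _) b@(rb , _) = begin
      countᵇ (reachesWith a b) allΩ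
        ≡⟨ count-cong (reachesWith≡ a b) allΩ ⟩
      countᵇ (λ ω → admissible a b ∧ generates a b ω) allΩ
        ≡⟨ count-∧ˡ (admissible a b) (generates a b) allΩ ⟩
      ind (admissible a b) * countᵇ (generates a b) allΩ
        ≡⟨ cong (ind (admissible a b) *_) (trans
             (count-cartesianProduct (λ r → does (ra ≟Vec r)) (λ z → does (rb ≟Vec proj₁ z) ∧ consistent ℓ (proj₂ z) C)
                                     (allVec ρa) _)
             (cong₂ _*_ (allVec-Enumerates ρa _ (does-Selects ra (ra ≟Vec_)))
                        (trans (count-cartesianProduct (λ r → does (rb ≟Vec r)) (λ H → consistent ℓ H C) (allVec ρb) _)
                               (cong (_* #consistent ℓ C) (allVec-Enumerates ρb _ (does-Selects rb (rb ≟Vec_))))))) ⟩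
      ind (admissible a b) * (1 * (1 * #consistent ℓ C))
        ≡⟨ cong (ind (admissible a b) *_) (trans (ℕP.*-identityˡ _) (ℕP.*-identityˡ _)) ⟩
      ind (admissible a b) * #consistent ℓ C ∎
      where
      open ≡-Reasoning
      C = jointClaims a b
      _≟Vec_ : ∀ {ρ} → DecidableEquality (Vec Bool ρ)
      _≟Vec_ = VecP.≡-dec BoolP._≟_

    F : ViewA → ℕ
    F a = ind (wellFormedA M a) * #consistent ℓ (claimsA a M ++ I)

    G : ViewB → ℕ
    G b = ind (wellFormedB M b) * #consistent ℓ (claimsB b M ++ I)

    good⇒SharedWithin : ∀ a b → T (goodV M I a b) → SharedWithin (claimsA a M) (claimsB b M) I
    good⇒SharedWithin a b good q q∈A q∈B =
      elemS⇒∈ (queriesOf I)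
        (T-⇒ {elemS q (queriesB b M)}
             (all-∈ (λ q′ → not (elemS q′ (queriesB b M)) ∨ elemS q′ (queriesOf I)) (queriesA a M) good
                    (subst (q ∈_) (queriesOf-claimsA a M) q∈A))
             (∈⇒elemS (queriesB b M) (subst (q ∈_) (queriesOf-claimsB b M) q∈B)))

    countAB-factorises : eveFollowsStrategy h ≡ true → ∀ a b →
      countAB h a b * #consistent ℓ I ≡ ind (goodV M I a b) * (F a * G b)
    countAB-factorises follows a b = begin
      countAB h a b * #consistent ℓ I
        ≡⟨ cong (_* #consistent ℓ I) (countAB≡ a b) ⟩
      ind (admissible a b) * #consistent ℓ (jointClaims a b) * #consistent ℓ I
        ≡⟨ cong (λ e → ind (e ∧ (goodV M I a b ∧ (wellFormedA M a ∧ wellFormedB M b)))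
                         * #consistent ℓ (jointClaims a b) * #consistent ℓ I) follows ⟩
      ind (goodV M I a b ∧ (wellFormedA M a ∧ wellFormedB M b)) * #consistent ℓ (jointClaims a b) * #consistent ℓ I
        ≡⟨ by-goodness (goodV M I a b)
             (λ good → #consistent-independent ℓ (claimsA a M) (claimsB b M) I (good⇒SharedWithin a b good)) ⟩
      ind (goodV M I a b) * (F a * G b) ∎
      where
      open ≡-Reasoning
      by-goodness : ∀ g → (T g → #consistent ℓ (jointClaims a b) * #consistent ℓ I
                                ≡ #consistent ℓ (claimsA a M ++ I) * #consistent ℓ (claimsB b M ++ I)) →
        ind (g ∧ (wellFormedA M a ∧ wellFormedB M b)) * #consistent ℓ (jointClaims a b) * #consistent ℓ I
          ≡ ind g * (F a * G b)
      by-goodness false _ = refl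
      by-goodness true  independent = begin
        ind (x ∧ y) * N * NI                ≡⟨ ℕP.*-assoc (ind (x ∧ y)) N NI ⟩
        ind (x ∧ y) * (N * NI)              ≡⟨ cong₂ _*_ (ind-∧ x y) (independent tt) ⟩
        (ind x * ind y) * (N₁ * N₂)         ≡⟨ *-interchange (ind x) (ind y) N₁ N₂ ⟩
        (ind x * N₁) * (ind y * N₂)         ≡⟨ sym (ℕP.*-identityˡ _) ⟩
        1 * (F a * G b) ∎
        where
        x = wellFormedA M a
        y = wellFormedB M b
        N = #consistent ℓ (jointClaims a b)
        NI = #consistent ℓ I
        N₁ = #consistent ℓ (claimsA a M ++ I)
        N₂ = #consistent ℓ (claimsB b M ++ I)

    reachesWith-unique : ∀ ω → sumMap (λ a → sumMap (λ b → ind (reachesWith a b ω)) (supB k)) (supA k) ≡ ind (goodAt h ω)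
    reachesWith-unique ω@(ra , rb , H) = begin
      sumMap (λ a → sumMap (λ b → ind (g ∧ (x a ∧ y b))) (supB k)) (supA k)
        ≡⟨ sumMap-cong (λ a → sumMap-cong (λ b → split a b) (supB k)) (supA k) ⟩
      sumMap (λ a → sumMap (λ b → (ind g * ind (x a)) * ind (y b)) (supB k)) (supA k)
        ≡⟨ sumMap-cong (λ a → sumMap-*ˡ (ind g * ind (x a)) (λ b → ind (y b)) (supB k)) (supA k) ⟩
      sumMap (λ a → (ind g * ind (x a)) * sumMap (λ b → ind (y b)) (supB k)) (supA k)
        ≡⟨ sumMap-cong (λ a → cong ((ind g * ind (x a)) *_) #B) (supA k) ⟩
      sumMap (λ a → (ind g * ind (x a)) * 1) (supA k)
        ≡⟨ sumMap-cong (λ a → ℕP.*-identityʳ _) (supA k) ⟩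
      sumMap (λ a → ind g * ind (x a)) (supA k)
        ≡⟨ sumMap-*ˡ (ind g) (λ a → ind (x a)) (supA k) ⟩
      ind g * sumMap (λ a → ind (x a)) (supA k)
        ≡⟨ cong (ind g *_) #A ⟩
      ind g * 1
        ≡⟨ ℕP.*-identityʳ _ ⟩
      ind g ∎
      where
      open ≡-Reasoning
      g = goodAt h ω
      x = λ a → viewA ω k ==VA a
      y = λ b → viewB ω k ==VB b
      split : ∀ a b → ind (g ∧ (x a ∧ y b)) ≡ (ind g * ind (x a)) * ind (y b)
      split a b = trans (ind-∧ g _) (trans (cong (ind g *_) (ind-∧ (x a) (y b))) (sym (ℕP.*-assoc (ind g) _ _)))
      #A : sumMap (λ a → ind (x a)) (supA k) ≡ 1
      #A = trans (sym (count≡sum x (supA k))) (count-views ra _ (length-viewA ra rb H k))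
      #B : sumMap (λ b → ind (y b)) (supB k) ≡ 1
      #B = trans (sym (count≡sum y (supB k))) (count-views rb _ (length-viewB ra rb H k))

    sum-countAB : sumMap (λ a → sumMap (countAB h a) (supB k)) (supA k) ≡ goodCount h
    sum-countAB = begin
      sumMap (λ a → sumMap (countAB h a) (supB k)) (supA k)
        ≡⟨ sumMap-cong (λ a → sumMap-cong (λ b → count≡sum (reachesWith a b) allΩ) (supB k)) (supA k) ⟩
      sumMap (λ a → sumMap (λ b → sumMap (λ ω → ind (reachesWith a b ω)) allΩ) (supB k)) (supA k)
        ≡⟨ sumMap-cong (λ a → sumMap-comm (λ b ω → ind (reachesWith a b ω)) (supB k) allΩ) (supA k) ⟩
      sumMap (λ a → sumMap (λ ω → sumMap (λ b → ind (reachesWith a b ω)) (supB k)) allΩ) (supA k)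
        ≡⟨ sumMap-comm (λ a ω → sumMap (λ b → ind (reachesWith a b ω)) (supB k)) (supA k) allΩ ⟩
      sumMap (λ ω → sumMap (λ a → sumMap (λ b → ind (reachesWith a b ω)) (supB k)) (supA k)) allΩ
        ≡⟨ sumMap-cong reachesWith-unique allΩ ⟩
      sumMap (λ ω → ind (goodAt h ω)) allΩ
        ≡⟨ sym (count≡sum (goodAt h) allΩ) ⟩
      goodCount h ∎
      where open ≡-Reasoning

    F-outside : ∀ a → a ∉ supA k → F a ≡ 0
    F-outside a@(ra , ha) a∉ with wellFormedA M a in wf
    ... | false = refl
    ... | true  = ⊥-elim (a∉ (∈-views ra ha (does⁻ (length ha ℕP.≟ nA k)
                    (proj₁ (T-∧⁻ {does (length ha ℕP.≟ nA k)} {sentByA ra ha M k} (subst T (sym wf) tt))))))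

    G-outside : ∀ b → b ∉ supB k → G b ≡ 0
    G-outside b@(rb , hb) b∉ with wellFormedB M b in wf
    ... | false = refl
    ... | true  = ⊥-elim (b∉ (∈-views rb hb (does⁻ (length hb ℕP.≟ nB k)
                    (proj₁ (T-∧⁻ {does (length hb ℕP.≟ nB k)} {sentByB rb hb M k} (subst T (sym wf) tt))))))

    weightedGood : ℕ
    weightedGood = sumMap (λ a → sumMap (λ b → ind (goodV M I a b) * (F a * G b)) (supB k)) (supA k)

    goodCount-factorises : eveFollowsStrategy h ≡ true → goodCount h * #consistent ℓ I ≡ weightedGood
    goodCount-factorises follows = begin
      goodCount h * NI
        ≡⟨ cong (_* NI) (sym sum-countAB) ⟩
      sumMap (λ a → sumMap (countAB h a) (supB k)) (supA k) * NI
        ≡⟨ sumMap-*ʳ NI _ (supA k) ⟩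
      sumMap (λ a → sumMap (countAB h a) (supB k) * NI) (supA k)
        ≡⟨ sumMap-cong (λ a → trans (sumMap-*ʳ NI (countAB h a) (supB k))
                                    (sumMap-cong (countAB-factorises follows a) (supB k))) (supA k) ⟩
      weightedGood ∎
      where
      open ≡-Reasoning
      NI = #consistent ℓ I

    weightedGood≤ : weightedGood ≤ sumMap F (supA k) * sumMap G (supB k)
    weightedGood≤ = ℕP.≤-trans
      (sumMap-mono-≤ (λ a → sumMap-mono-≤ (λ b → ind-* (goodV M I a b) (F a * G b)) (supB k)) (supA k))
      (ℕP.≤-reflexive (trans (sumMap-cong (λ a → sumMap-*ˡ (F a) G (supB k)) (supA k))
                             (sym (sumMap-*ʳ (sumMap G (supB k)) F (supA k)))))

    good⇒strategy : 0 < goodCount h → eveFollowsStrategy h ≡ true × 0 < #consistent ℓ I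
    good⇒strategy pos with count>0⇒∃ (goodAt h) allΩ pos
    ... | ω@(ra , rb , H) , ω∈ , good =
      T-true (proj₁ reached) , ∃⇒count>0 (λ H′ → consistent ℓ H′ I) (allOracleT ℓ ℓ) H∈ (proj₂ (proj₂ reached))
      where
      reached = reach⇒ ω h (proj₁ (T-∧⁻ {reach ω h} {goodV M I (viewA ω k) (viewB ω k)} good))
      H∈ = proj₂ (∈-cartesianProduct⁻ (allVec ρb) (allOracleT ℓ ℓ) (proj₂ (∈-cartesianProduct⁻ (allVec ρa) _ ω∈)))

    conditionedProduct : 0 < goodCount h →
      Σ[ 𝒜 ∈ Dist (supA k) ] Σ[ ℬ ∈ Dist (supB k) ] GEXECisCondProduct n ε h 𝒜 ℬ
    conditionedProduct pos = 𝒜.dist , ℬ.dist , D-pos , D-eqn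
      where
      follows = proj₁ (good⇒strategy pos)
      weightedGood-pos : 0 < weightedGood
      weightedGood-pos = subst (0 <_) (goodCount-factorises follows) (*-pos⁺ _ _ pos (proj₂ (good⇒strategy pos)))
      F,G-pos = *-pos⁻ _ _ (ℕP.<-≤-trans weightedGood-pos weightedGood≤)
      open NormalisedProduct F F-outside (proj₁ F,G-pos) G G-outside (proj₂ F,G-pos) (goodV M I)
      D≡ : normaliser k M I 𝒜.dist ℬ.dist ≡ toℚ weightedGood ℚ.* factor
      D≡ = sum-product-weight
      D-pos : 0ℚ ℚ.< normaliser k M I 𝒜.dist ℬ.dist
      D-pos = subst (0ℚ ℚ.<_) (sym D≡) (ℚP.positive⁻¹ (toℚ weightedGood ℚ.* factor)
                {{ℚP.pos*pos⇒pos (toℚ weightedGood) {{toℚ-pos weightedGood weightedGood-pos}} factor {{factor-positive}}}})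
      D-eqn : ∀ a b → toℚ (countAB h a b) ℚ.* normaliser k M I 𝒜.dist ℬ.dist
                      ≡ toℚ (goodCount h) ℚ.* condProdWeight k M I 𝒜.dist ℬ.dist a b
      D-eqn a b = trans (cong (toℚ (countAB h a b) ℚ.*_) D≡)
        (trans (toℚ-rescale (countAB h a b) (goodCount h) (#consistent ℓ I) _ weightedGood factor
                  (sym (goodCount-factorises follows)) (countAB-factorises follows a b))
               (cong (toℚ (goodCount h) ℚ.*_) (sym (product-weight a b))))

lemma4p4 : ∀ {ℓ ρa ρb : ℕ} (P : Protocol ℓ ρa ρb) (n : ℕ) → Model.NoRepeat P n
    → (ε : ℚ) → 0ℚ <ℚ ε
    → (h : History ℓ)
    → length (msgsOf h) < 2 * n
    → Model.Eve.eveNext P n ε h ≡ nothing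
    → 0 < Model.Eve.goodCount P n ε h
    → Σ[ 𝒜 ∈ Dist (Model.supA P (length (msgsOf h))) ]
    Σ[ ℬ ∈ Dist (Model.supB P (length (msgsOf h))) ]
    Model.GEXECisCondProduct P n ε h 𝒜 ℬ
lemma4p4 P n _ ε _ h _ _ pos = Conditioning.AtHistory.conditionedProduct P n ε h pos
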